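{- Let $\sigma$ be a non-crossing partition of $[\bar n]=\{\bar1,\ldots,\bar n\}$, let $\widetilde\sigma$ be its dual non-crossing partition of $\{\widetilde1,\ldots,\widetilde n\}$ (where $\widetilde i$ lies between $\bar i$ and $\overline{i+1}$ on the circle, and $\widetilde n$ between $\bar n$ and $\bar 1$), and let $(\sigma|\widetilde\sigma)$ be the merged non-crossing partition of $[2n]$ obtained via the identification $\{1,2,\ldots,2n-1,2n\}=\{\bar1,\widetilde1,\ldots,\bar n,\widetilde n\}$. Let $e_1,\ldots,e_{2n}$ be the standard basis of $\mathbb R^{2n}$, and let $$w_\sigma=\sum_I e_{i_1}\wedge\cdots\wedge e_{i_{n-1}}\in\textstyle\bigwedge^{n-1}\mathbb R^{2n},$$ the sum being over all $(n-1)$-element subsets $I=\{i_1<\cdots<i_{n-1}\}\subset[2n]$ such that each part of $\sigma$ and each part of $\widetilde\sigma$ contains exactly one element not in $I$ (the concordance vector of $\sigma$). Let $V\subset\mathbb R^{2n}$ be the subspace with basis $v_i=e_i+e_{i+2}$, $i=1,\ldots,2n-2$. Then $w_\sigma$ is obtained as follows. 1. Write the parts of $(\sigma|\widetilde\sigma)$, each with its elements in increasing order: $(\sigma|\widetilde\sigma)=(i_1 i_2\ldots i_k|i_{k+1}\ldots i_l|\ldots|i_{p+1}\ldots i_{2n})$, with $i_1<i_{k+1}<\ldots<i_{p+1}$. 2. Form the formal product of "brackets" $(i_1\,i_2)(i_2\,i_3)\ldots(i_{k-1}\,i_k)(i_{k+1}\,i_{k+2})\ldots(i_{l-1}\,i_l)\ldots(i_{2n-1}\,i_{2n})$,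 i.e. one bracket $(i_x\,i_{x+1})$ for every pair of consecutive elements of the same part; here $i_s$ stands for $e_{i_s}$ and the product is a wedge product. 3. Reorder the brackets so that their first indices increase, and replace each bracket $(i_x\,i_{x+1})$ by the vector $e_{i_x}+(-1)^{m}e_{i_{x+1}}$, where $m$ is the number of integers in the open interval $(i_x,i_{x+1})$ having the same parity as $i_x$ (and $i_{x+1}$; they always have the same parity). The resulting wedge product of these $n-1$ vectors equals $w_\sigma$. 4. Rewriting in the basis of $V$, each such factor equals $$e_{i_x}\pm e_{i_{x+1}}=v_{i_x}-v_{i_x+2}+v_{i_x+4}-\cdots+(-1)^{\frac{i_{x+1}-2-i_x}{2}}v_{i_{x+1}-2},$$ so $w_\sigma$ is a pure wedge product of elements of $V$; in particular $w_\sigma\in\bigwedge^{n-1}V$.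
   Context: Electrical networks with $n$ boundary vertices; non-crossing partitions of $[\bar n]$ and their duals; concordance vectors $w_\sigma$ spanning the concordance space $H\subset\bigwedge^{n-1}\mathbb R^{2n}$; $V=\{v\in\mathbb R^{2n}:\sum_i(-1)^iv_{2i}=0,\ \sum_i(-1)^iv_{2i-1}=0\}$ with basis $v_i=e_i+e_{i+2}$. -}

module Defs where

open import Data.Nat using (ℕ; zero; suc; _+_; _*_; _∸_; _≤_; _<_; _/_; _%_; ⌊_/2⌋)
open import Data.Nat.Properties using (_≟_)
open import Data.Integer as ℤ using (ℤ; +_)
open import Data.List using (List; []; _∷_; map; filter; drop; length; upTo; concatMap; foldr)
open import Data.List.Membership.Propositional using (_∈_)
open import Data.Bool using (Bool; true; false; not; if_then_else_)
open import Data.Product using (_×_; _,_; Σ; proj₁; proj₂)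
open import Relation.Nullary using (¬_; does)
open import Relation.Binary.PropositionalEquality using (_≡_)

-- A set partition of {1,…,N} is encoded by a block labelling
-- lab : ℕ → ℕ ; points x, y (in range 1..N) lie in the same part iff lab x ≡ lab y.
-- Values outside 1..N are never consulted.
Labelling : Set
Labelling = ℕ → ℕ

InRange : ℕ → ℕ → Set
InRange n i = 1 ≤ i × i ≤ n

-- non-crossing partition of {1,…,N} (linear order = circular order here)
NonCrossing : ℕ → Labelling → Set
NonCrossing N lab = ∀ a b c d → 1 ≤ a → a < b → b < c → c < d → d ≤ N →
  lab a ≡ lab c → lab b ≡ lab d → lab a ≡ lab b

isEven : ℕ → Bool
isEven zero = true
isEven (suc n) = not (isEven n)

-- merged partition (σ|τ) of [2n] via 2i-1 = ī , 2i = ĩ.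
-- σ-blocks get even labels, τ-blocks odd labels, so blocks never merge.
merge : Labelling → Labelling → Labelling
merge σ τ p = if isEven p then suc (2 * τ ⌊ p /2⌋) else 2 * σ ⌊ suc p /2⌋

-- τ is the dual (Kreweras complement) of σ: the coarsest partition of the
-- tilde points such that the merged partition (σ|τ) is non-crossing.
IsDual : ℕ → Labelling → Labelling → Set
IsDual n σ τ = NonCrossing (2 * n) (merge σ τ) ×
  (∀ (τ' : Labelling) → NonCrossing (2 * n) (merge σ τ') →
     ∀ i j → InRange n i → InRange n j → τ' i ≡ τ' j → τ i ≡ τ j)

ExactlyOne : ℕ → (ℕ → Set) → Set
ExactlyOne n P = Σ ℕ λ j → InRange n j × P j × (∀ j' → InRange n j' → P j' → j' ≡ j)

Concordant : ℕ → Labelling → Labelling → List ℕ → Set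
Concordant n σ τ I =
  (∀ i → InRange n i → ExactlyOne n (λ j → σ j ≡ σ i × ¬ ((2 * j ∸ 1) ∈ I))) ×
  (∀ i → InRange n i → ExactlyOne n (λ j → τ j ≡ τ i × ¬ ((2 * j) ∈ I)))

range : ℕ → List ℕ
range m = map suc (upTo m)

successors : ℕ → Labelling → ℕ → List ℕ
successors N lab a = filter (λ b → lab a ≟ lab b) (drop a (range N))

firstOf : ℕ → List ℕ → List (ℕ × ℕ)
firstOf a [] = []
firstOf a (b ∷ _) = (a , b) ∷ []

brackets : ℕ → Labelling → List (ℕ × ℕ)
brackets N lab = concatMap (λ a → firstOf a (successors N lab a)) (range N)

bracketsOf : ℕ → Labelling → Labelling → List (ℕ × ℕ)
bracketsOf n σ τ = brackets (2 * n) (merge σ τ)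

between : ℕ → ℕ → List ℕ
between a b = drop a (range (b ∸ 1))

mcount : ℕ → ℕ → ℕ
mcount a b = length (filter (λ c → c % 2 ≟ a % 2) (between a b))

sgn : ℕ → ℤ
sgn k = if isEven k then + 1 else ℤ.- (+ 1)

-- vectors of ℤ^{2n} as functions of the (1-based) coordinate index
Vector : Set
Vector = ℕ → ℤ

e : ℕ → Vector
e a p = if does (p ≟ a) then + 1 else + 0

factor : ℕ × ℕ → Vector
factor (a , b) p = e a p ℤ.+ sgn (mcount a b) ℤ.* e b p

vV : ℕ → Vector
vV i p = e i p ℤ.+ e (i + 2) p

altsum : ℕ × ℕ → Vector
altsum (a , b) p =
  foldr ℤ._+_ (+ 0) (map (λ j → sgn j ℤ.* vV (a + 2 * j) p) (upTo ((b ∸ a) / 2)))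

dropCol : ℕ → List ℤ → List ℤ
dropCol _ [] = []
dropCol zero (x ∷ xs) = xs
dropCol (suc j) (x ∷ xs) = x ∷ dropCol j xs

det : ℕ → List (List ℤ) → ℤ
lap : ℕ → ℕ → List ℤ → List (List ℤ) → ℤ
det zero _ = + 1
det (suc k) [] = + 1
det (suc k) (r ∷ rs) = lap k 0 r rs
lap k j [] rs = + 0
lap k j (x ∷ xs) rs = sgn j ℤ.* x ℤ.* det k (map (dropCol j) rs) ℤ.+ lap k (suc j) xs rs

-- coefficient of e_{i_1} ∧ … ∧ e_{i_k} (I = i_1 < … < i_k) in the wedge
-- product v_1 ∧ … ∧ v_k of the list vs: the minor det (v_r(i_c))_{r,c}
wedgeCoeff : List Vector → List ℕ → ℤ
wedgeCoeff vs I = det (length vs) (map (λ v → map v I) vs)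

module Submission where

-- Write lab for the merged partition (σ|τ) of [2n] and call a pair a < b of consecutive
-- points of a block a bracket. Since (σ|τ) is non-crossing and x, x + 1 never share a
-- block, no x has both a later block-mate and x + 1 an earlier one; maximality of τ shows
-- that, apart from the end of the block of 1, every x has one of the two. Counting points
-- with a successor gives n - 1 brackets, and for a bracket (a , b) the points strictly
-- between a and b form a union of blocks containing exactly (b - a - 2)/2 = m points
-- that have a successor.
--
-- The coefficient of e_I is computed by Laplace expansion along the bracket (c , b) with
-- the smallest first index, by downward induction on c. The row e_c ± e_b meets I only in
-- c and b; when column b is used, concordance makes I miss exactly one point of each block
-- between c and b, so I has m points there and the Laplace sign (-1)^m cancels the sign
-- of e_b. Finally e_a ± e_b = v_a - v_{a+2} + … telescopes because v_i = e_i + e_{i+2}.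

open import Defs
open import Data.Nat
open import Data.Nat.Properties
open import Data.Nat.DivMod using ([m+n]%n≡m%n; [m+kn]%n≡m%n; m*n/n≡m)
open import Data.Nat.Tactic.RingSolver using (solve-∀)
open import Data.Integer as ℤ using (ℤ; +_; -_; _-_)
import Data.Integer.Properties as ℤP
import Data.Integer.Tactic.RingSolver as ℤSolver
open import Data.Bool using (Bool; true; false; not; _∧_; _∨_; T; if_then_else_)
open import Data.Bool.Properties using (not-injective; not-involutive; not-¬; ∧-zeroʳ; ∧-identityʳ; ∨-identityʳ; ∨-zeroʳ; ∨-assoc)
open import Data.Empty using (⊥; ⊥-elim)
open import Data.Product using (Σ; _×_; _,_; proj₁; proj₂)
open import Data.Sum using (_⊎_; inj₁; inj₂)
open import Data.List using (List; []; _∷_; _++_; length; map; filter; drop; foldr; applyUpTo; null; concatMap)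
open import Data.List.Properties using (filter-accept; filter-reject; length-++; map-++; length-map; length-++-sucʳ)
open import Data.List.Relation.Unary.All as All using (All; []; _∷_) renaming (map to All-map)
import Data.List.Relation.Unary.All.Properties as Allₚ
open import Data.List.Relation.Unary.AllPairs using (AllPairs; []; _∷_)
open import Data.List.Relation.Unary.Any using (here; there)
open import Data.List.Relation.Unary.Linked using (Linked)
open import Data.List.Relation.Unary.Linked.Properties using (Linked⇒AllPairs)
open import Data.List.Membership.Propositional using (_∈_)
open import Data.List.Membership.Propositional.Properties using (∈-∃++; ∈-insert)
open import Function using (_∘_; _∘′_; _⇔_; mk⇔; Equivalence)
open import Algebra.Properties.CommutativeSemigroup +-commutativeSemigroup using (interchange)
open import Relation.Unary using (Decidable)
open import Relation.Nullary using (¬_; yes; no; does)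
open import Relation.Nullary.Decidable using (dec-true; dec-false)
open import Relation.Binary.PropositionalEquality hiding (J)
open import Relation.Binary.Definitions using (tri<; tri≈; tri>)

-- Counting over intervals

boolToℕ : Bool → ℕ
boolToℕ true = 1
boolToℕ false = 0

boolToℕ≡1 : ∀ {b} → boolToℕ b ≡ 1 → b ≡ true
boolToℕ≡1 {true} _ = refl

Within : ℕ → ℕ → ℕ → Set
Within c k x = c ≤ x × x < c + k

≡⇒≡ᵇ≡true : ∀ {m n} → m ≡ n → (m ≡ᵇ n) ≡ true
≡⇒≡ᵇ≡true {m} {n} = dec-true (m ≟ n)

≢⇒≡ᵇ≡false : ∀ {m n} → m ≢ n → (m ≡ᵇ n) ≡ false
≢⇒≡ᵇ≡false {m} {n} = dec-false (m ≟ n)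

≡ᵇ≡true⇒≡ : ∀ {m n} → (m ≡ᵇ n) ≡ true → m ≡ n
≡ᵇ≡true⇒≡ {m} {n} eq = ≡ᵇ⇒≡ m n (subst T (sym eq) _)

≡ᵇ≡false⇒≢ : ∀ {m n} → (m ≡ᵇ n) ≡ false → m ≢ n
≡ᵇ≡false⇒≢ {m} {n} eq m≡n = subst T eq (≡⇒≡ᵇ m n m≡n)

≡ᵇ-sym : ∀ m n → (m ≡ᵇ n) ≡ (n ≡ᵇ m)
≡ᵇ-sym m n with m ≟ n
... | yes m≡n = trans (≡⇒≡ᵇ≡true m≡n) (sym (≡⇒≡ᵇ≡true (sym m≡n)))
... | no m≢n = trans (≢⇒≡ᵇ≡false m≢n) (sym (≢⇒≡ᵇ≡false (m≢n ∘ sym)))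

sumFrom : (ℕ → ℕ) → ℕ → ℕ → ℕ
sumFrom f c zero = 0
sumFrom f c (suc k) = f c + sumFrom f (suc c) k

countFrom : (ℕ → Bool) → ℕ → ℕ → ℕ
countFrom P = sumFrom (λ x → boolToℕ (P x))

within-first : ∀ c k → Within c (suc k) c
within-first c k = ≤-refl , m<m+n c z<s

within-suc : ∀ {c k x} → Within (suc c) k x → Within c (suc k) x
within-suc {c} {k} {x} (c<x , x<) = <⇒≤ c<x , subst (x <_) (sym (+-suc c k)) x<

within-last : ∀ c k → Within c (suc k) (c + k)
within-last c k = m≤m+n c k , subst (c + k <_) (sym (+-suc c k)) ≤-refl

within-split : ∀ {c k x} → Within c (suc k) x → x ≡ c ⊎ Within (suc c) k x
within-split {c} {k} {x} (c≤x , x<) with m≤n⇒m<n∨m≡n c≤x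
... | inj₁ c<x = inj₂ (c<x , subst (x <_) (+-suc c k) x<)
... | inj₂ c≡x = inj₁ (sym c≡x)

within-zero : ∀ {c x} → ¬ Within c 0 x
within-zero {c} {x} (c≤x , x<) = <-irrefl refl (<-≤-trans x< (subst (_≤ x) (sym (+-identityʳ c)) c≤x))

within-between : ∀ {a b y} → a < y → y < b → Within (suc a) (b ∸ suc a) y
within-between {a} {b} {y} a<y y<b = a<y , subst (y <_) (sym (m+[n∸m]≡n (<-trans a<y y<b))) y<b

between-within : ∀ {a b y} → a < b → Within (suc a) (b ∸ suc a) y → a < y × y < b
between-within {a} {b} {y} a<b (a<y , y<) = a<y , subst (y <_) (m+[n∸m]≡n a<b) y<

within-≤ : ∀ {c k k' x} → k ≤ k' → Within c k x → Within c k' x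
within-≤ {c} k≤k' (c≤x , x<) = c≤x , ≤-trans x< (+-monoʳ-≤ c k≤k')

sumFrom-cong : ∀ {f g} c k → (∀ x → Within c k x → f x ≡ g x) → sumFrom f c k ≡ sumFrom g c k
sumFrom-cong c zero f≗g = refl
sumFrom-cong c (suc k) f≗g =
  cong₂ _+_ (f≗g c (within-first c k)) (sumFrom-cong (suc c) k (λ x r → f≗g x (within-suc r)))

sumFrom-zero : ∀ {f} c k → (∀ x → Within c k x → f x ≡ 0) → sumFrom f c k ≡ 0
sumFrom-zero c zero f≗0 = refl
sumFrom-zero c (suc k) f≗0 =
  cong₂ _+_ (f≗0 c (within-first c k)) (sumFrom-zero (suc c) k (λ x r → f≗0 x (within-suc r)))

sumFrom-+ : ∀ f c k l → sumFrom f c (k + l) ≡ sumFrom f c k + sumFrom f (c + k) l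
sumFrom-+ f c zero l = cong (λ c' → sumFrom f c' l) (sym (+-identityʳ c))
sumFrom-+ f c (suc k) l = begin
  f c + sumFrom f (suc c) (k + l)                        ≡⟨ cong (_+_ (f c)) (sumFrom-+ f (suc c) k l) ⟩
  f c + (sumFrom f (suc c) k + sumFrom f (suc c + k) l)  ≡⟨ sym (+-assoc (f c) _ _) ⟩
  f c + sumFrom f (suc c) k + sumFrom f (suc c + k) l    ≡⟨ cong (λ c' → f c + sumFrom f (suc c) k + sumFrom f c' l) (sym (+-suc c k)) ⟩
  f c + sumFrom f (suc c) k + sumFrom f (c + suc k) l    ∎
  where open ≡-Reasoning

sumFrom-last : ∀ f c k → sumFrom f c (suc k) ≡ sumFrom f c k + f (c + k)
sumFrom-last f c k = begin
  sumFrom f c (suc k)                  ≡⟨ cong (sumFrom f c) (+-comm 1 k) ⟩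
  sumFrom f c (k + 1)                  ≡⟨ sumFrom-+ f c k 1 ⟩
  sumFrom f c k + (f (c + k) + 0)      ≡⟨ cong (_+_ (sumFrom f c k)) (+-identityʳ _) ⟩
  sumFrom f c k + f (c + k)            ∎
  where open ≡-Reasoning

sumFrom-shift : ∀ f c k → sumFrom (λ x → f (suc x)) c k ≡ sumFrom f (suc c) k
sumFrom-shift f c zero = refl
sumFrom-shift f c (suc k) = cong (_+_ (f (suc c))) (sumFrom-shift f (suc c) k)

sumFrom-distrib-+ : ∀ f g c k → sumFrom (λ x → f x + g x) c k ≡ sumFrom f c k + sumFrom g c k
sumFrom-distrib-+ f g c zero = refl
sumFrom-distrib-+ f g c (suc k) =
  trans (cong (_+_ (f c + g c)) (sumFrom-distrib-+ f g (suc c) k)) (interchange (f c) (g c) _ _)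

sumFrom-*ˡ : ∀ m f c k → sumFrom (λ x → m * f x) c k ≡ m * sumFrom f c k
sumFrom-*ˡ m f c zero = sym (*-zeroʳ m)
sumFrom-*ˡ m f c (suc k) =
  trans (cong (_+_ (m * f c)) (sumFrom-*ˡ m f (suc c) k)) (sym (*-distribˡ-+ m (f c) _))

sumFrom-swap : ∀ (f : ℕ → ℕ → ℕ) c k d l →
  sumFrom (λ x → sumFrom (f x) d l) c k ≡ sumFrom (λ y → sumFrom (λ x → f x y) c k) d l
sumFrom-swap f c zero d l = sym (sumFrom-zero d l (λ _ _ → refl))
sumFrom-swap f c (suc k) d l =
  trans (cong (_+_ (sumFrom (f c) d l)) (sumFrom-swap f (suc c) k d l))
        (sym (sumFrom-distrib-+ (f c) (λ y → sumFrom (λ x → f x y) (suc c) k) d l))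

countFrom-none : ∀ P c k → (∀ x → Within c k x → P x ≡ false) → countFrom P c k ≡ 0
countFrom-none P c k none = sumFrom-zero c k (λ x r → cong boolToℕ (none x r))

countFrom-pos : ∀ P c k x → Within c k x → P x ≡ true → 1 ≤ countFrom P c k
countFrom-pos P c zero x r _ = ⊥-elim (within-zero r)
countFrom-pos P c (suc k) x r Px with within-split r
... | inj₁ refl rewrite Px = s≤s z≤n
... | inj₂ r' = ≤-trans (countFrom-pos P (suc c) k x r' Px) (m≤n+m _ (boolToℕ (P c)))

countFrom-unique : ∀ P c k w → Within c k w → P w ≡ true →
  (∀ x → Within c k x → P x ≡ true → x ≡ w) → countFrom P c k ≡ 1
countFrom-unique P c zero w r _ _ = ⊥-elim (within-zero r)
countFrom-unique P c (suc k) w r Pw unique with within-split r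
... | inj₁ refl rewrite Pw = cong suc (countFrom-none P (suc c) k others)
  where
  others : ∀ x → Within (suc c) k x → P x ≡ false
  others x r' with P x in Px
  ... | false = refl
  ... | true = ⊥-elim (<-irrefl (sym (unique x (within-suc r') Px)) (proj₁ r'))
... | inj₂ r' with P c in Pc
... | true = ⊥-elim (<-irrefl (unique c (within-first c k) Pc) (proj₁ r'))
... | false = countFrom-unique P (suc c) k w r' Pw (λ x r'' → unique x (within-suc r''))

countFrom≡1⇒unique : ∀ P c k → countFrom P c k ≡ 1 →
  Σ ℕ λ w → Within c k w × P w ≡ true × (∀ x → Within c k x → P x ≡ true → x ≡ w)
countFrom≡1⇒unique P c (suc k) count≡1 with P c in Pc
... | true = c , within-first c k , Pc , unique
  where
  unique : ∀ x → Within c (suc k) x → P x ≡ true → x ≡ c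
  unique x r Px with within-split r
  ... | inj₁ x≡c = x≡c
  ... | inj₂ r' = ⊥-elim (<-irrefl (sym (suc-injective count≡1)) (countFrom-pos P (suc c) k x r' Px))
... | false with countFrom≡1⇒unique P (suc c) k count≡1
... | w , r , Pw , unique' = w , within-suc r , Pw , unique
  where
  unique : ∀ x → Within c (suc k) x → P x ≡ true → x ≡ w
  unique x r' Px with within-split r'
  ... | inj₁ refl with () ← trans (sym Px) Pc
  ... | inj₂ r'' = unique' x r'' Px

countFrom-two : ∀ P c k x y → Within c k x → Within c k y → x < y → P x ≡ true → P y ≡ true →
  2 ≤ countFrom P c k
countFrom-two P c zero x y rx _ _ _ _ = ⊥-elim (within-zero rx)
countFrom-two P c (suc k) x y rx ry x<y Px Py with within-split rx | within-split ry
... | inj₁ refl | inj₁ refl = ⊥-elim (<-irrefl refl x<y)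
... | inj₁ refl | inj₂ ry' rewrite Px = s≤s (countFrom-pos P (suc c) k y ry' Py)
... | inj₂ rx' | inj₁ refl = ⊥-elim (<-asym (proj₁ rx') x<y)
... | inj₂ rx' | inj₂ ry' =
  ≤-trans (countFrom-two P (suc c) k x y rx' ry' x<y Px Py) (m≤n+m _ (boolToℕ (P c)))

countFrom-not : ∀ P c k → countFrom (λ x → not (P x)) c k + countFrom P c k ≡ k
countFrom-not P c zero = refl
countFrom-not P c (suc k) with P c
... | true = trans (+-suc _ _) (cong suc (countFrom-not P (suc c) k))
... | false = cong suc (countFrom-not P (suc c) k)

countFrom-∨ : ∀ P Q c k → (∀ x → Within c k x → P x ≡ true → Q x ≡ false) →
  countFrom (λ x → P x ∨ Q x) c k ≡ countFrom P c k + countFrom Q c k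
countFrom-∨ P Q c k disjoint = trans (sumFrom-cong c k pointwise) (sumFrom-distrib-+ _ _ c k)
  where
  pointwise : ∀ x → Within c k x → boolToℕ (P x ∨ Q x) ≡ boolToℕ (P x) + boolToℕ (Q x)
  pointwise x r with P x in Px
  ... | true rewrite disjoint x r Px = refl
  ... | false = refl

countFrom-≡ᵇ : ∀ (Q : ℕ → Bool) b c k → Within c k b → countFrom (λ x → (x ≡ᵇ b) ∧ Q x) c k ≡ boolToℕ (Q b)
countFrom-≡ᵇ Q b c k rb with Q b in Qb
... | true = countFrom-unique _ c k b rb (trans (cong (_∧ Q b) (≡⇒≡ᵇ≡true {b} refl)) Qb)
               (λ x _ h → ≡ᵇ≡true⇒≡ (∧-true-left h))
  where
  ∧-true-left : ∀ {p q} → (p ∧ q) ≡ true → p ≡ true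
  ∧-true-left {true} _ = refl
... | false = countFrom-none _ c k none
  where
  none : ∀ x → Within c k x → ((x ≡ᵇ b) ∧ Q x) ≡ false
  none x _ with x ≡ᵇ b in x≡b
  ... | false = refl
  ... | true = subst (λ y → Q y ≡ false) (sym (≡ᵇ≡true⇒≡ x≡b)) Qb

OneInEachClass : (ℕ → ℕ → Bool) → (ℕ → Bool) → ℕ → ℕ → Set
OneInEachClass rel Q c k = ∀ y → Within c k y → countFrom (λ x → rel y x ∧ Q x) c k ≡ 1

-- Double counting of the pairs (x , y) with x ~ y, Q x and R y.
representatives-equinumerous : ∀ rel Q R c k → (∀ x y → rel x y ≡ rel y x) →
  OneInEachClass rel Q c k → OneInEachClass rel R c k → countFrom Q c k ≡ countFrom R c k
representatives-equinumerous rel Q R c k rel-sym oneQ oneR = begin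
  sumFrom (λ x → boolToℕ (Q x)) c k
    ≡⟨ sumFrom-cong c k (λ x r → trans (sym (*-identityʳ _)) (cong (boolToℕ (Q x) *_) (sym (oneR x r)))) ⟩
  sumFrom (λ x → boolToℕ (Q x) * countFrom (λ y → rel x y ∧ R y) c k) c k
    ≡⟨ sumFrom-cong c k (λ x _ → sym (sumFrom-*ˡ (boolToℕ (Q x)) _ c k)) ⟩
  sumFrom (λ x → sumFrom (λ y → pair x y) c k) c k
    ≡⟨ sumFrom-swap pair c k c k ⟩
  sumFrom (λ y → sumFrom (λ x → pair x y) c k) c k
    ≡⟨ sumFrom-cong c k (λ y _ → sumFrom-cong c k (λ x _ → pair-swap x y)) ⟩
  sumFrom (λ y → sumFrom (λ x → boolToℕ (R y) * boolToℕ (rel y x ∧ Q x)) c k) c k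
    ≡⟨ sumFrom-cong c k (λ y r → trans (sumFrom-*ˡ (boolToℕ (R y)) _ c k)
                                   (trans (cong (boolToℕ (R y) *_) (oneQ y r)) (*-identityʳ _))) ⟩
  sumFrom (λ y → boolToℕ (R y)) c k ∎
  where
  open ≡-Reasoning
  pair : ℕ → ℕ → ℕ
  pair x y = boolToℕ (Q x) * boolToℕ (rel x y ∧ R y)
  swap-∧ : ∀ q r e → boolToℕ q * boolToℕ (e ∧ r) ≡ boolToℕ r * boolToℕ (e ∧ q)
  swap-∧ true true e = refl
  swap-∧ q r false = trans (*-zeroʳ (boolToℕ q)) (sym (*-zeroʳ (boolToℕ r)))
  swap-∧ true false true = refl
  swap-∧ false true true = refl
  swap-∧ false false true = refl
  pair-swap : ∀ x y → pair x y ≡ boolToℕ (R y) * boolToℕ (rel y x ∧ Q x)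
  pair-swap x y = trans (swap-∧ (Q x) (R y) (rel x y)) (cong (λ e → boolToℕ (R y) * boolToℕ (e ∧ Q x)) (rel-sym x y))

interval : ℕ → ℕ → List ℕ
interval c zero = []
interval c (suc k) = c ∷ interval (suc c) k

applyUpTo-interval : ∀ (f : ℕ → ℕ) c k → (∀ i → f i ≡ c + i) → applyUpTo f k ≡ interval c k
applyUpTo-interval f c zero f≗ = refl
applyUpTo-interval f c (suc k) f≗ =
  cong₂ _∷_ (trans (f≗ 0) (+-identityʳ c)) (applyUpTo-interval (f ∘ suc) (suc c) k (λ i → trans (f≗ (suc i)) (+-suc c i)))

drop-interval : ∀ a c k → drop a (interval c k) ≡ interval (c + a) (k ∸ a)
drop-interval zero c k = cong (λ c' → interval c' k) (sym (+-identityʳ c))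
drop-interval (suc a) c zero = refl
drop-interval (suc a) c (suc k) = trans (drop-interval a (suc c) k) (cong (λ c' → interval c' (k ∸ a)) (sym (+-suc c a)))

length-filter-interval : ∀ {P : ℕ → Set} (P? : Decidable P) c k →
  length (filter P? (interval c k)) ≡ countFrom (λ x → does (P? x)) c k
length-filter-interval P? c zero = refl
length-filter-interval P? c (suc k) with does (P? c)
... | true = cong suc (length-filter-interval P? (suc c) k)
... | false = length-filter-interval P? (suc c) k

data FirstMatch {P : ℕ → Set} (P? : Decidable P) (c k : ℕ) : Set where
  noMatch : filter P? (interval c k) ≡ [] → (∀ y → Within c k y → ¬ P y) → FirstMatch P? c k
  firstMatch : ∀ b rest → filter P? (interval c k) ≡ b ∷ rest → Within c k b → P b →
    (∀ y → c ≤ y → y < b → ¬ P y) → FirstMatch P? c k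

firstMatch? : ∀ {P : ℕ → Set} (P? : Decidable P) c k → FirstMatch P? c k
firstMatch? P? c zero = noMatch refl (λ y r → ⊥-elim (within-zero r))
firstMatch? P? c (suc k) with P? c
... | yes Pc = firstMatch c _ (filter-accept P? Pc) (within-first c k) Pc (λ y c≤y y<c → ⊥-elim (<-irrefl refl (≤-trans y<c c≤y)))
... | no ¬Pc with firstMatch? P? (suc c) k
...   | noMatch none ¬P = noMatch (trans (filter-reject P? ¬Pc) none) earlier
  where
  earlier : ∀ y → Within c (suc k) y → ¬ _
  earlier y r with within-split r
  ... | inj₁ refl = ¬Pc
  ... | inj₂ r' = ¬P y r'
...   | firstMatch b rest first rb Pb ¬P = firstMatch b rest (trans (filter-reject P? ¬Pc) first) (within-suc rb) Pb earlier
  where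
  earlier : ∀ y → c ≤ y → y < b → ¬ _
  earlier y c≤y y<b with m≤n⇒m<n∨m≡n c≤y
  ... | inj₁ c<y = ¬P y c<y y<b
  ... | inj₂ refl = ¬Pc

-- Blocks of a labelling

map-suc-interval : ∀ c k → map suc (interval c k) ≡ interval (suc c) k
map-suc-interval c zero = refl
map-suc-interval c (suc k) = cong (suc c ∷_) (map-suc-interval (suc c) k)

range-interval : ∀ m → range m ≡ interval 1 m
range-interval m = trans (cong (map suc) (applyUpTo-interval (λ i → i) 0 m (λ i → refl))) (map-suc-interval 0 m)

module Blocks (N : ℕ) (lab : Labelling) where

  sameBlock : ℕ → ℕ → Bool
  sameBlock x y = lab x ≡ᵇ lab y

  sameBlock-sym : ∀ x y → sameBlock x y ≡ sameBlock y x
  sameBlock-sym x y = ≡ᵇ-sym (lab x) (lab y)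

  hasNext : ℕ → Bool
  hasNext a = not (null (successors N lab a))

  predecessors : ℕ → List ℕ
  predecessors y = filter (λ x → lab y ≟ lab x) (interval 1 (y ∸ 1))

  hasPrev : ℕ → Bool
  hasPrev y = not (null (predecessors y))

  successors-interval : ∀ a → successors N lab a ≡ filter (λ b → lab a ≟ lab b) (interval (suc a) (N ∸ a))
  successors-interval a = cong (filter (λ b → lab a ≟ lab b)) (trans (cong (drop a) (range-interval N)) (drop-interval a 1 N))

  record IsNext (a b : ℕ) : Set where
    constructor isNext
    field
      a<b : a < b
      b≤N : b ≤ N
      same : lab a ≡ lab b
      ¬between : ∀ y → a < y → y < b → lab a ≢ lab y

  data NextView (a : ℕ) : Set where
    last : hasNext a ≡ false → firstOf a (successors N lab a) ≡ [] →
      (∀ y → a < y → y ≤ N → lab a ≢ lab y) → NextView a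
    next : ∀ b → hasNext a ≡ true → firstOf a (successors N lab a) ≡ (a , b) ∷ [] → IsNext a b → NextView a

  within-tail : ∀ {a y} → Within (suc a) (N ∸ a) y → y ≤ N
  within-tail {a} {y} (a<y , y<) with a ≤? N
  ... | yes a≤N = ≤-pred (subst (y <_) (cong suc (m+[n∸m]≡n a≤N)) y<)
  ... | no a≰N = ⊥-elim (within-zero (a<y , subst (λ d → y < suc a + d) (m≤n⇒m∸n≡0 (≰⇒≥ a≰N)) y<))

  tail-within : ∀ {a y} → a < y → y ≤ N → Within (suc a) (N ∸ a) y
  tail-within {a} {y} a<y y≤N = a<y , s≤s (subst (y ≤_) (sym (m+[n∸m]≡n (≤-trans (<⇒≤ a<y) y≤N))) y≤N)

  nextView : ∀ a → NextView a
  nextView a with firstMatch? (λ b → lab a ≟ lab b) (suc a) (N ∸ a)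
  ... | noMatch none ¬same =
    last (cong (not ∘′ null) (trans (successors-interval a) none)) (cong (firstOf a) (trans (successors-interval a) none))
         (λ y a<y y≤N → ¬same y (tail-within a<y y≤N))
  ... | firstMatch b rest first rb same ¬same =
    next b (cong (not ∘′ null) (trans (successors-interval a) first)) (cong (firstOf a) (trans (successors-interval a) first))
         (isNext (proj₁ rb) (within-tail rb) same ¬same)

  data PrevView (y : ℕ) : Set where
    first : hasPrev y ≡ false → (∀ x → 1 ≤ x → x < y → lab y ≢ lab x) → PrevView y
    prev : ∀ x → hasPrev y ≡ true → 1 ≤ x → x < y → lab y ≡ lab x → PrevView y

  prevView : ∀ y → PrevView y
  prevView y with firstMatch? (λ x → lab y ≟ lab x) 1 (y ∸ 1)
  ... | noMatch none ¬same = first (cong (not ∘′ null) none) (λ x 1≤x x<y → ¬same x (1≤x , <-≤-trans x<y (m≤n+m∸n y 1)))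
  ... | firstMatch x rest found (1≤x , x<) same _ = prev x (cong (not ∘′ null) found) 1≤x x<y same
    where
    x≤y∸1 : x ≤ y ∸ 1
    x≤y∸1 = ≤-pred x<
    x<y : x < y
    x<y = subst (_≤ y) (+-comm x 1) (m≤o∸n⇒m+n≤o x (≤-trans 1≤x (≤-trans x≤y∸1 (m∸n≤m y 1))) x≤y∸1)

  hasNext≡false⇒ : ∀ {a} → hasNext a ≡ false → ∀ y → a < y → y ≤ N → lab a ≢ lab y
  hasNext≡false⇒ {a} noNext with nextView a
  ... | last _ _ ¬later = ¬later
  ... | next _ hasNext≡true _ _ with () ← trans (sym hasNext≡true) noNext

  hasNext≡true : ∀ {a y} → a < y → y ≤ N → lab a ≡ lab y → hasNext a ≡ true
  hasNext≡true {a} a<y y≤N same with hasNext a in h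
  ... | true = refl
  ... | false = ⊥-elim (hasNext≡false⇒ h _ a<y y≤N same)

  hasPrev≡false⇒ : ∀ {y} → hasPrev y ≡ false → ∀ x → 1 ≤ x → x < y → lab y ≢ lab x
  hasPrev≡false⇒ {y} noPrev with prevView y
  ... | first _ ¬earlier = ¬earlier
  ... | prev _ hasPrev≡true _ _ _ with () ← trans (sym hasPrev≡true) noPrev

  hasPrev≡true : ∀ {y x} → 1 ≤ x → x < y → lab y ≡ lab x → hasPrev y ≡ true
  hasPrev≡true {y} 1≤x x<y same with hasPrev y in h
  ... | true = refl
  ... | false = ⊥-elim (hasPrev≡false⇒ h _ 1≤x x<y same)

  lastOfBlock : ∀ y → y ≤ N → Σ ℕ λ z → y ≤ z × z ≤ N × lab y ≡ lab z × hasNext z ≡ false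
  lastOfBlock y y≤N = search (N ∸ y) y ≤-refl y≤N
    where
    search : ∀ fuel y → N ∸ y ≤ fuel → y ≤ N → Σ ℕ λ z → y ≤ z × z ≤ N × lab y ≡ lab z × hasNext z ≡ false
    search fuel y enough y≤N with nextView y
    ... | last noNext _ _ = y , ≤-refl , y≤N , refl , noNext
    search zero y enough y≤N | next b _ _ (isNext y<b b≤N _ _) = ⊥-elim (n≮0 (<-≤-trans (∸-monoʳ-< y<b b≤N) enough))
    search (suc fuel) y enough y≤N | next b _ _ (isNext y<b b≤N same _)
      with search fuel b (≤-pred (<-≤-trans (∸-monoʳ-< y<b b≤N) enough)) b≤N
    ... | z , b≤z , z≤N , same' , noNext = z , ≤-trans (<⇒≤ y<b) b≤z , z≤N , trans same same' , noNext

  firstOfBlock : ∀ y → 1 ≤ y → Σ ℕ λ z → 1 ≤ z × z ≤ y × lab y ≡ lab z × hasPrev z ≡ false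
  firstOfBlock y 1≤y = search y y ≤-refl 1≤y
    where
    search : ∀ fuel y → y ≤ fuel → 1 ≤ y → Σ ℕ λ z → 1 ≤ z × z ≤ y × lab y ≡ lab z × hasPrev z ≡ false
    search fuel y enough 1≤y with prevView y
    ... | first noPrev _ = y , 1≤y , ≤-refl , refl , noPrev
    search zero y enough 1≤y | prev _ _ _ _ _ = ⊥-elim (n≮0 (≤-trans 1≤y enough))
    search (suc fuel) y enough 1≤y | prev x _ 1≤x x<y same
      with search fuel x (≤-pred (<-≤-trans x<y enough)) 1≤x
    ... | z , 1≤z , z≤x , same' , noPrev = z , 1≤z , ≤-trans z≤x (<⇒≤ x<y) , trans same same' , noPrev

  InBounds : ℕ → ℕ → Set
  InBounds c k = 1 ≤ c × c + k ≤ suc N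

  BlockClosed : ℕ → ℕ → Set
  BlockClosed c k = ∀ y x → Within c k y → 1 ≤ x → x ≤ N → lab y ≡ lab x → Within c k x

  inBounds : ∀ {c k x} → InBounds c k → Within c k x → 1 ≤ x × x ≤ N
  inBounds (1≤c , bound) (c≤x , x<) = ≤-trans 1≤c c≤x , ≤-pred (≤-trans x< bound)

  oneLastPerBlock : ∀ c k → InBounds c k → BlockClosed c k → OneInEachClass sameBlock (λ x → not (hasNext x)) c k
  oneLastPerBlock c k bounds closed y ry with inBounds bounds ry
  ... | 1≤y , y≤N with lastOfBlock y y≤N
  ... | z , y≤z , z≤N , same , noNext =
    countFrom-unique _ c k z (closed y z ry (≤-trans 1≤y y≤z) z≤N same) (cong₂ _∧_ (≡⇒≡ᵇ≡true same) (cong not noNext)) unique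
    where
    unique : ∀ x → Within c k x → (sameBlock y x ∧ not (hasNext x)) ≡ true → x ≡ z
    unique x rx hx with sameBlock y x in yx | hasNext x in noNextx
    ... | true | false with <-cmp x z
    ...   | tri≈ _ x≡z _ = x≡z
    ...   | tri< x<z _ _ = ⊥-elim (hasNext≡false⇒ noNextx z x<z z≤N (trans (sym (≡ᵇ≡true⇒≡ yx)) same))
    ...   | tri> _ _ z<x = ⊥-elim (hasNext≡false⇒ noNext x z<x (proj₂ (inBounds bounds rx)) (trans (sym same) (≡ᵇ≡true⇒≡ yx)))

  oneFirstPerBlock : ∀ c k → InBounds c k → BlockClosed c k → OneInEachClass sameBlock (λ x → not (hasPrev x)) c k
  oneFirstPerBlock c k bounds closed y ry with inBounds bounds ry
  ... | 1≤y , y≤N with firstOfBlock y 1≤y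
  ... | z , 1≤z , z≤y , same , noPrev =
    countFrom-unique _ c k z (closed y z ry 1≤z (≤-trans z≤y y≤N) same) (cong₂ _∧_ (≡⇒≡ᵇ≡true same) (cong not noPrev)) unique
    where
    unique : ∀ x → Within c k x → (sameBlock y x ∧ not (hasPrev x)) ≡ true → x ≡ z
    unique x rx hx with sameBlock y x in yx | hasPrev x in noPrevx
    ... | true | false with <-cmp x z
    ...   | tri≈ _ x≡z _ = x≡z
    ...   | tri< x<z _ _ = ⊥-elim (hasPrev≡false⇒ noPrev x (proj₁ (inBounds bounds rx)) x<z (trans (sym same) (≡ᵇ≡true⇒≡ yx)))
    ...   | tri> _ _ z<x = ⊥-elim (hasPrev≡false⇒ noPrevx z 1≤z z<x (trans (sym (≡ᵇ≡true⇒≡ yx)) same))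

  -- Q misses exactly one point per block, as "has a successor" misses the last one.
  countFrom≡countNext : ∀ Q c k → InBounds c k → BlockClosed c k →
    OneInEachClass sameBlock (λ x → not (Q x)) c k → countFrom Q c k ≡ countFrom hasNext c k
  countFrom≡countNext Q c k bounds closed oneMissing = +-cancelˡ-≡ (countFrom (λ x → not (Q x)) c k) _ _ (begin
    countFrom (λ x → not (Q x)) c k + countFrom Q c k               ≡⟨ countFrom-not Q c k ⟩
    k                                                               ≡⟨ sym (countFrom-not hasNext c k) ⟩
    countFrom (λ x → not (hasNext x)) c k + countFrom hasNext c k   ≡⟨ cong (_+ countFrom hasNext c k) (sym blocks) ⟩
    countFrom (λ x → not (Q x)) c k + countFrom hasNext c k         ∎)
    where
    open ≡-Reasoning
    blocks : countFrom (λ x → not (Q x)) c k ≡ countFrom (λ x → not (hasNext x)) c k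
    blocks = representatives-equinumerous sameBlock _ _ c k sameBlock-sym oneMissing (oneLastPerBlock c k bounds closed)

  closed-lastHasNoNext : ∀ c k → BlockClosed c (suc k) → hasNext (c + k) ≡ false
  closed-lastHasNoNext c k closed with nextView (c + k)
  ... | last noNext _ _ = noNext
  ... | next b _ _ (isNext c+k<b b≤N same _) with closed (c + k) b (within-last c k) (≤-trans (s≤s z≤n) c+k<b) b≤N same
  ...   | _ , b< = ⊥-elim (<-irrefl refl (<-≤-trans c+k<b (≤-pred (subst (b <_) (+-suc c k) b<))))

  closed-firstHasNoPrev : ∀ c k → c ≤ N → BlockClosed c (suc k) → hasPrev c ≡ false
  closed-firstHasNoPrev c k c≤N closed with prevView c
  ... | first noPrev _ = noPrev
  ... | prev x _ 1≤x x<c same with closed c x (within-first c k) 1≤x (≤-trans (<⇒≤ x<c) c≤N) same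
  ...   | c≤x , _ = ⊥-elim (<-irrefl refl (<-≤-trans x<c c≤x))

  isGap : ℕ → Bool
  isGap x = not (hasNext x ∨ hasPrev (suc x))

  bracketsFrom : ℕ → ℕ → List (ℕ × ℕ)
  bracketsFrom c k = concatMap (λ a → firstOf a (successors N lab a)) (interval c k)

  length-bracketsFrom : ∀ c k → length (bracketsFrom c k) ≡ countFrom hasNext c k
  length-bracketsFrom c zero = refl
  length-bracketsFrom c (suc k) = trans (length-++ (firstOf c (successors N lab c))) (cong₂ _+_ length-first (length-bracketsFrom (suc c) k))
    where
    length-first : length (firstOf c (successors N lab c)) ≡ boolToℕ (hasNext c)
    length-first with successors N lab c
    ... | [] = refl
    ... | _ ∷ _ = refl

  All-bracketsFrom : ∀ {P : ℕ × ℕ → Set} →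
    (∀ {a b} → 1 ≤ a → IsNext a b → P (a , b)) →
    ∀ c k → 1 ≤ c → All P (bracketsFrom c k)
  All-bracketsFrom P-bracket c zero 1≤c = []
  All-bracketsFrom P-bracket c (suc k) 1≤c = Allₚ.++⁺ P-first (All-bracketsFrom P-bracket (suc c) k (s≤s z≤n))
    where
    P-first : All _ (firstOf c (successors N lab c))
    P-first with nextView c
    ... | last _ noBracket _ rewrite noBracket = []
    ... | next b _ bracket b-next rewrite bracket = P-bracket 1≤c b-next ∷ []

  isGap≡true⇒ : ∀ x → isGap x ≡ true → hasNext x ≡ false × hasPrev (suc x) ≡ false
  isGap≡true⇒ x gap with hasNext x | hasPrev (suc x)
  ... | false | false = refl , refl

  module Alternating (nc : NonCrossing N lab) (alt : ∀ x → lab x ≢ lab (suc x)) where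

    -- A block continuing after x and a block reaching x+1 from the left would cross.
    ¬next∧prev : ∀ {x} → 1 ≤ x → suc x ≤ N → hasNext x ≡ true → hasPrev (suc x) ≡ true → ⊥
    ¬next∧prev {x} 1≤x x<N hasNext≡true hasPrev≡true with nextView x | prevView (suc x)
    ... | last noNext _ _ | _ with () ← trans (sym hasNext≡true) noNext
    ... | _ | first noPrev _ with () ← trans (sym hasPrev≡true) noPrev
    ... | next b _ _ (isNext x<b b≤N same _) | prev c _ 1≤c c<1+x same' with m≤n⇒m<n∨m≡n (≤-pred c<1+x) | m≤n⇒m<n∨m≡n x<b
    ...   | inj₂ refl | _ = alt c (sym same')
    ...   | _ | inj₂ refl = alt x same
    ...   | inj₁ c<x | inj₁ 1+x<b =
            alt x (trans (sym (nc c x (suc x) b 1≤c c<x ≤-refl 1+x<b b≤N (sym same') same)) (sym same'))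

    -- A non-gap x < c + k has a successor or x + 1 has a predecessor, never both.
    countNext-closed : ∀ c k → InBounds c (suc k) → BlockClosed c (suc k) →
      2 * countFrom hasNext c (suc k) + countFrom isGap c k ≡ k
    countNext-closed c k bounds@(1≤c , bound) closed = begin
      2 * X + countFrom isGap c k                          ≡⟨ cong (_+ countFrom isGap c k) (cong (_+_ X) (+-identityʳ X)) ⟩
      X + X + countFrom isGap c k                          ≡⟨ +-comm (X + X) _ ⟩
      countFrom isGap c k + (X + X)
        ≡⟨ cong (_+_ (countFrom isGap c k)) (cong₂ _+_ lastDropped (trans nexts≡prevs firstDropped)) ⟩
      countFrom isGap c k + (countFrom hasNext c k + countFrom (λ x → hasPrev (suc x)) c k)
                                                           ≡⟨ cong (_+_ (countFrom isGap c k)) (sym (countFrom-∨ _ _ c k disjoint)) ⟩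
      countFrom isGap c k + countFrom (λ x → hasNext x ∨ hasPrev (suc x)) c k ≡⟨ countFrom-not _ c k ⟩
      k ∎
      where
      open ≡-Reasoning
      X = countFrom hasNext c (suc k)
      nexts≡prevs : X ≡ countFrom hasPrev c (suc k)
      nexts≡prevs = sym (countFrom≡countNext hasPrev c (suc k) bounds closed (oneFirstPerBlock c (suc k) bounds closed))
      lastDropped : X ≡ countFrom hasNext c k
      lastDropped = begin
        X                                                ≡⟨ sumFrom-last _ c k ⟩
        countFrom hasNext c k + boolToℕ (hasNext (c + k))
          ≡⟨ cong (λ b → countFrom hasNext c k + boolToℕ b) (closed-lastHasNoNext c k closed) ⟩
        countFrom hasNext c k + 0                         ≡⟨ +-identityʳ _ ⟩
        countFrom hasNext c k ∎
      c≤N : c ≤ N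
      c≤N = proj₂ (inBounds bounds (within-first c k))
      firstDropped : countFrom hasPrev c (suc k) ≡ countFrom (λ x → hasPrev (suc x)) c k
      firstDropped = begin
        boolToℕ (hasPrev c) + countFrom hasPrev (suc c) k
          ≡⟨ cong (λ b → boolToℕ b + countFrom hasPrev (suc c) k) (closed-firstHasNoPrev c k c≤N closed) ⟩
        countFrom hasPrev (suc c) k                        ≡⟨ sym (sumFrom-shift _ c k) ⟩
        countFrom (λ x → hasPrev (suc x)) c k ∎
      disjoint : ∀ x → Within c k x → hasNext x ≡ true → hasPrev (suc x) ≡ false
      disjoint x (c≤x , x<) hasNext≡true with hasPrev (suc x) in h
      ... | false = refl
      ... | true = ⊥-elim (¬next∧prev (≤-trans 1≤c c≤x) (≤-trans x< (≤-pred (subst (_≤ suc N) (+-suc c k) bound))) hasNext≡true h)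

    nextInterval-closed : ∀ {a b} → 1 ≤ a → IsNext a b → BlockClosed (suc a) (b ∸ suc a)
    nextInterval-closed {a} {b} 1≤a (isNext a<b b≤N same ¬between) y x ry 1≤x x≤N same' with between-within a<b ry
    ... | a<y , y<b with <-cmp x a
    ...   | tri≈ _ refl _ = ⊥-elim (¬between y a<y y<b (sym same'))
    ...   | tri< x<a _ _ = ⊥-elim (¬between y a<y y<b (trans (sym (nc x a y b 1≤x x<a a<y y<b b≤N (sym same') same)) (sym same')))
    ...   | tri> _ _ a<x with <-cmp x b
    ...     | tri< x<b _ _ = within-between a<x x<b
    ...     | tri≈ _ refl _ = ⊥-elim (¬between y a<y y<b (trans same (sym same')))
    ...     | tri> _ _ b<x = ⊥-elim (¬between y a<y y<b (nc a y b x 1≤a a<y y<b b<x x≤N same same'))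

    module GapsInFirstBlock (gapInFirstBlock : ∀ x → 1 ≤ x → suc x ≤ N → isGap x ≡ true → lab x ≡ lab 1) where

      nextInterval-count : ∀ {a b} → 1 ≤ a → IsNext a b → a + 2 * suc (countFrom hasNext (suc a) (b ∸ suc a)) ≡ b
      nextInterval-count {a} {b} 1≤a b-next@(isNext a<b b≤N same ¬between) with b ∸ suc a in b-a-1
      ... | zero = ⊥-elim (alt a (subst (λ b → lab a ≡ lab b) b≡1+a same))
        where
        b≡1+a : b ≡ suc a
        b≡1+a = ≤-antisym (m∸n≡0⇒m≤n b-a-1) a<b
      ... | suc k = begin
        a + 2 * suc X          ≡⟨ shuffle a X ⟩
        suc a + suc (2 * X)    ≡⟨ cong (λ m → suc a + suc m) twiceX≡k ⟩
        suc a + suc k          ≡⟨ b≡ ⟩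
        b                      ∎
        where
        open ≡-Reasoning
        X = countFrom hasNext (suc a) (suc k)
        shuffle : ∀ a x → a + 2 * suc x ≡ suc a + suc (2 * x)
        shuffle = solve-∀
        b≡ : suc a + suc k ≡ b
        b≡ = trans (cong (_+_ (suc a)) (sym b-a-1)) (m+[n∸m]≡n a<b)
        closed : BlockClosed (suc a) (suc k)
        closed = subst (BlockClosed (suc a)) b-a-1 (nextInterval-closed 1≤a b-next)
        bounds : InBounds (suc a) (suc k)
        bounds = s≤s z≤n , ≤-trans (≤-reflexive b≡) (≤-trans b≤N (n≤1+n N))
        noGap : ∀ x → Within (suc a) k x → isGap x ≡ false
        noGap x rx@(a<x , x<) with isGap x in gap
        ... | false = refl
        ... | true with closed x 1 (within-≤ (n≤1+n k) rx) ≤-refl (≤-trans (≤-trans (s≤s z≤n) a<b) b≤N) (gapInFirstBlock x 1≤x x<N gap)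
          where
          1≤x : 1 ≤ x
          1≤x = ≤-trans (s≤s z≤n) a<x
          x<N : suc x ≤ N
          x<N = ≤-trans x< (≤-trans (+-monoʳ-≤ (suc a) (n≤1+n k)) (≤-trans (≤-reflexive b≡) b≤N))
        ...   | a<1 , _ = ⊥-elim (<-irrefl refl (<-≤-trans (s≤s 1≤a) a<1))
        twiceX≡k : 2 * X ≡ k
        twiceX≡k = begin
          2 * X                                  ≡⟨ sym (+-identityʳ _) ⟩
          2 * X + 0                              ≡⟨ cong (_+_ (2 * X)) (sym (countFrom-none isGap (suc a) k noGap)) ⟩
          2 * X + countFrom isGap (suc a) k      ≡⟨ countNext-closed (suc a) k bounds closed ⟩
          k                                      ∎

      -- The only gap is at the end of the block of 1.
      countGaps≡1 : 1 ≤ N → lab N ≢ lab 1 → countFrom isGap 1 (N ∸ 1) ≡ 1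
      countGaps≡1 1≤N lab[N]≢lab[1] with lastOfBlock 1 1≤N
      ... | z , 1≤z , z≤N , same , noNext = countFrom-unique isGap 1 (N ∸ 1) z rz gap unique
        where
        z<N : z < N
        z<N with m≤n⇒m<n∨m≡n z≤N
        ... | inj₁ z<N = z<N
        ... | inj₂ refl = ⊥-elim (lab[N]≢lab[1] (sym same))
        rz : Within 1 (N ∸ 1) z
        rz = 1≤z , subst (z <_) (sym (m+[n∸m]≡n 1≤N)) z<N
        noPrev : hasPrev (suc z) ≡ false
        noPrev with prevView (suc z)
        ... | first noPrev _ = noPrev
        ... | prev c _ 1≤c c<1+z same' with m≤n⇒m<n∨m≡n (≤-pred c<1+z)
        ...   | inj₂ refl = ⊥-elim (alt c (sym same'))
        ...   | inj₁ c<z with m≤n⇒m<n∨m≡n 1≤c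
        ...     | inj₂ refl = ⊥-elim (alt z (trans (sym same) (sym same')))
        ...     | inj₁ 1<c = ⊥-elim (alt z (trans (sym same) (trans (nc 1 c z (suc z) ≤-refl 1<c c<z ≤-refl z<N same (sym same')) (sym same'))))
        gap : isGap z ≡ true
        gap = cong₂ (λ p q → not (p ∨ q)) noNext noPrev
        unique : ∀ x → Within 1 (N ∸ 1) x → isGap x ≡ true → x ≡ z
        unique x (1≤x , x<) gap' with isGap≡true⇒ x gap' | <-cmp x z
        ... | _ | tri≈ _ x≡z _ = x≡z
        ... | noNext' , _ | tri< x<z _ _ = ⊥-elim (hasNext≡false⇒ noNext' z x<z z≤N (trans (gapInFirstBlock x 1≤x x<N gap') same))
          where
          x<N : suc x ≤ N
          x<N = subst (suc x ≤_) (m+[n∸m]≡n 1≤N) x<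
        ... | _ | tri> _ _ z<x = ⊥-elim (hasNext≡false⇒ noNext x z<x x≤N (trans (sym same) (sym (gapInFirstBlock x 1≤x x<N gap'))))
          where
          x<N : suc x ≤ N
          x<N = subst (suc x ≤_) (m+[n∸m]≡n 1≤N) x<
          x≤N : x ≤ N
          x≤N = <⇒≤ x<N

      countNext-total : 1 ≤ N → lab N ≢ lab 1 → 2 * suc (countFrom hasNext 1 N) ≡ N
      countNext-total 1≤N lab[N]≢lab[1] = begin
        2 * suc X                                  ≡⟨ cong (λ n → 2 * suc (countFrom hasNext 1 n)) (sym N≡) ⟩
        2 * suc X'                                 ≡⟨ shuffle X' ⟩
        suc (2 * X' + 1)                           ≡⟨ cong (λ g → suc (2 * X' + g)) (sym (countGaps≡1 1≤N lab[N]≢lab[1])) ⟩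
        suc (2 * X' + countFrom isGap 1 M)         ≡⟨ cong suc (countNext-closed 1 M bounds closed) ⟩
        suc M                                      ≡⟨ N≡ ⟩
        N                                          ∎
        where
        open ≡-Reasoning
        M = N ∸ 1
        N≡ : suc M ≡ N
        N≡ = m+[n∸m]≡n 1≤N
        X = countFrom hasNext 1 N
        X' = countFrom hasNext 1 (suc M)
        shuffle : ∀ x → 2 * suc x ≡ suc (2 * x + 1)
        shuffle = solve-∀
        bounds : InBounds 1 (suc M)
        bounds = ≤-refl , s≤s (≤-reflexive N≡)
        closed : BlockClosed 1 (suc M)
        closed y x _ 1≤x x≤N _ = 1≤x , s≤s (subst (x ≤_) (sym N≡) x≤N)

-- Parity counts and the telescoping sum

2+n%2≡n%2 : ∀ a → (2 + a) % 2 ≡ a % 2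
2+n%2≡n%2 a = trans (cong (_% 2) (+-comm 2 a)) ([m+n]%n≡m%n a 2)

1+n%2≢n%2 : ∀ a → suc a % 2 ≢ a % 2
1+n%2≢n%2 zero ()
1+n%2≢n%2 (suc zero) ()
1+n%2≢n%2 (suc (suc a)) eq = 1+n%2≢n%2 a (trans (sym (2+n%2≡n%2 (suc a))) (trans eq (2+n%2≡n%2 a)))

[m+2k]%2≡m%2 : ∀ a k → (a + 2 * k) % 2 ≡ a % 2
[m+2k]%2≡m%2 a k = trans (cong (λ x → (a + x) % 2) (*-comm 2 k)) ([m+kn]%n≡m%n a k 2)

⌊1+2n/2⌋≡n : ∀ m → ⌊ suc (2 * m) /2⌋ ≡ m
⌊1+2n/2⌋≡n zero = refl
⌊1+2n/2⌋≡n (suc m) = cong suc (trans (cong ⌊_/2⌋ (+-suc m (m + 0))) (⌊1+2n/2⌋≡n m))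

sameParity : ℕ → ℕ → Bool
sameParity a x = x % 2 ≡ᵇ a % 2

countSameParity : ∀ a k → countFrom (sameParity a) (suc a) k ≡ ⌊ k /2⌋
countSameParity a zero = refl
countSameParity a (suc zero) rewrite ≢⇒≡ᵇ≡false (1+n%2≢n%2 a) = refl
countSameParity a (suc (suc k)) rewrite ≢⇒≡ᵇ≡false (1+n%2≢n%2 a) | ≡⇒≡ᵇ≡true (2+n%2≡n%2 a) =
  cong suc (trans (sumFrom-cong (3 + a) k (λ x _ → cong boolToℕ (cong (x % 2 ≡ᵇ_) (sym (2+n%2≡n%2 a)))))
                  (countSameParity (2 + a) k))

mcount-gap : ∀ a m → mcount a (a + 2 * suc m) ≡ m
mcount-gap a m = begin
  mcount a b                                  ≡⟨ cong (λ xs → length (filter (λ c → c % 2 ≟ a % 2) xs)) between≡ ⟩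
  length (filter (λ c → c % 2 ≟ a % 2) (interval (suc a) (b ∸ 1 ∸ a)))
                                              ≡⟨ length-filter-interval (λ c → c % 2 ≟ a % 2) (suc a) (b ∸ 1 ∸ a) ⟩
  countFrom (sameParity a) (suc a) (b ∸ 1 ∸ a) ≡⟨ countSameParity a (b ∸ 1 ∸ a) ⟩
  ⌊ b ∸ 1 ∸ a /2⌋                             ≡⟨ cong ⌊_/2⌋ length≡ ⟩
  ⌊ suc (2 * m) /2⌋                           ≡⟨ ⌊1+2n/2⌋≡n m ⟩
  m                                           ∎
  where
  open ≡-Reasoning
  b = a + 2 * suc m
  between≡ : between a b ≡ interval (suc a) (b ∸ 1 ∸ a)
  between≡ = trans (cong (drop a) (range-interval (b ∸ 1))) (drop-interval a 1 (b ∸ 1))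
  split : ∀ a m → a + 2 * suc m ≡ suc a + suc (2 * m)
  split = solve-∀
  length≡ : b ∸ 1 ∸ a ≡ suc (2 * m)
  length≡ = trans (∸-+-assoc b 1 a) (trans (cong (_∸ suc a) (split a m)) (m+n∸m≡n (suc a) (suc (2 * m))))

sumℤ : (ℕ → ℤ) → ℕ → ℤ
sumℤ g zero = + 0
sumℤ g (suc k) = g 0 ℤ.+ sumℤ (g ∘ suc) k

foldr-applyUpTo : ∀ (g : ℕ → ℤ) (f : ℕ → ℕ) k → foldr ℤ._+_ (+ 0) (map g (applyUpTo f k)) ≡ sumℤ (g ∘ f) k
foldr-applyUpTo g f zero = refl
foldr-applyUpTo g f (suc k) = cong (λ z → g (f 0) ℤ.+ z) (foldr-applyUpTo g (f ∘ suc) k)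

sumℤ-cong : ∀ {g h} k → (∀ j → g j ≡ h j) → sumℤ g k ≡ sumℤ h k
sumℤ-cong zero g≗h = refl
sumℤ-cong (suc k) g≗h = cong₂ ℤ._+_ (g≗h 0) (sumℤ-cong k (g≗h ∘ suc))

sumℤ-telescope : ∀ g k → sumℤ (λ j → g j - g (suc j)) k ≡ g 0 - g k
sumℤ-telescope g zero = sym (ℤP.+-inverseʳ (g 0))
sumℤ-telescope g (suc k) =
  trans (cong (λ z → g 0 - g 1 ℤ.+ z) (sumℤ-telescope (g ∘ suc) k)) (chain (g 0) (g 1) (g (suc k)))
  where
  chain : ∀ x y z → x - y ℤ.+ (y - z) ≡ x - z
  chain = ℤSolver.solve-∀

sgn-suc : ∀ j → sgn (suc j) ≡ - sgn j
sgn-suc j with isEven j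
... | true = refl
... | false = refl

factor≡altsum : ∀ {a b} m → a + 2 * suc m ≡ b → ∀ p → factor (a , b) p ≡ altsum (a , b) p
factor≡altsum {a} m refl p = sym (begin
  altsum (a , b) p                                          ≡⟨ foldr-applyUpTo _ (λ j → j) ((b ∸ a) / 2) ⟩
  sumℤ (λ j → sgn j ℤ.* vV (a + 2 * j) p) ((b ∸ a) / 2)     ≡⟨ cong (sumℤ _) halfGap ⟩
  sumℤ (λ j → sgn j ℤ.* vV (a + 2 * j) p) (suc m)           ≡⟨ sumℤ-cong (suc m) term ⟩
  sumℤ (λ j → g j - g (suc j)) (suc m)                      ≡⟨ sumℤ-telescope g (suc m) ⟩
  g 0 - g (suc m)                                           ≡⟨ cong₂ _-_ g0 (cong (λ s → s ℤ.* e b p) (sgn-suc m)) ⟩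
  e a p - (- sgn m) ℤ.* e b p                               ≡⟨ subtract-neg (e a p) (sgn m) (e b p) ⟩
  e a p ℤ.+ sgn m ℤ.* e b p                                 ≡⟨ cong (λ k → e a p ℤ.+ sgn k ℤ.* e b p) (sym (mcount-gap a m)) ⟩
  factor (a , b) p                                          ∎)
  where
  open ≡-Reasoning
  b = a + 2 * suc m
  g : ℕ → ℤ
  g j = sgn j ℤ.* e (a + 2 * j) p
  g0 : g 0 ≡ e a p
  g0 = trans (ℤP.*-identityˡ _) (cong (λ i → e i p) (+-identityʳ a))
  subtract-neg : ∀ x s y → x - (- s) ℤ.* y ≡ x ℤ.+ s ℤ.* y
  subtract-neg = ℤSolver.solve-∀
  distribute : ∀ s x y → s ℤ.* (x ℤ.+ y) ≡ s ℤ.* x - (- s) ℤ.* y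
  distribute = ℤSolver.solve-∀
  shift : ∀ a j → a + 2 * j + 2 ≡ a + 2 * suc j
  shift = solve-∀
  halfGap : (b ∸ a) / 2 ≡ suc m
  halfGap = trans (cong (_/ 2) (trans (m+n∸m≡n a (2 * suc m)) (*-comm 2 (suc m)))) (m*n/n≡m (suc m) 2)
  term : ∀ j → sgn j ℤ.* vV (a + 2 * j) p ≡ g j - g (suc j)
  term j = begin
    sgn j ℤ.* (e (a + 2 * j) p ℤ.+ e (a + 2 * j + 2) p)            ≡⟨ cong (λ i → sgn j ℤ.* (e (a + 2 * j) p ℤ.+ e i p)) (shift a j) ⟩
    sgn j ℤ.* (e (a + 2 * j) p ℤ.+ e (a + 2 * suc j) p)            ≡⟨ distribute (sgn j) _ _ ⟩
    g j - (- sgn j) ℤ.* e (a + 2 * suc j) p                         ≡⟨ cong (λ s → g j - s ℤ.* e (a + 2 * suc j) p) (sym (sgn-suc j)) ⟩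
    g j - g (suc j)                                                  ∎

-- Laplace expansion of wedge coefficients

deleteAt : {A : Set} → ℕ → List A → List A
deleteAt _ [] = []
deleteAt zero (x ∷ xs) = xs
deleteAt (suc j) (x ∷ xs) = x ∷ deleteAt j xs

deleteAt-middle : ∀ {A : Set} (xs : List A) y ys → deleteAt (length xs) (xs ++ y ∷ ys) ≡ xs ++ ys
deleteAt-middle [] y ys = refl
deleteAt-middle (x ∷ xs) y ys = cong (x ∷_) (deleteAt-middle xs y ys)

Sorted : List ℕ → Set
Sorted = AllPairs _<_

sorted-middle : ∀ xs y ys → Sorted (xs ++ y ∷ ys) → All (_< y) xs × All (y <_) ys × Sorted (xs ++ ys)
sorted-middle [] y ys (y<ys ∷ sorted) = [] , y<ys , sorted
sorted-middle (x ∷ xs) y ys (x<rest ∷ sorted) with sorted-middle xs y ys sorted | Allₚ.++⁻ xs x<rest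
... | xs<y , y<ys , sorted' | x<xs , x<y ∷ x<ys = x<y ∷ xs<y , y<ys , Allₚ.++⁺ x<xs x<ys ∷ sorted'

sorted-++⁻ˡ : ∀ xs {ys} → Sorted (xs ++ ys) → Sorted xs
sorted-++⁻ˡ [] _ = []
sorted-++⁻ˡ (x ∷ xs) (x<rest ∷ sorted) = Allₚ.++⁻ˡ xs x<rest ∷ sorted-++⁻ˡ xs sorted

All-deleteAt : ∀ {P : ℕ → Set} i xs → All P xs → All P (deleteAt i xs)
All-deleteAt i [] [] = []
All-deleteAt zero (x ∷ xs) (px ∷ pxs) = pxs
All-deleteAt (suc i) (x ∷ xs) (px ∷ pxs) = px ∷ All-deleteAt i xs pxs

sorted-deleteAt : ∀ i xs → Sorted xs → Sorted (deleteAt i xs)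
sorted-deleteAt i [] [] = []
sorted-deleteAt zero (x ∷ xs) (_ ∷ sorted) = sorted
sorted-deleteAt (suc i) (x ∷ xs) (x<xs ∷ sorted) = All-deleteAt i xs x<xs ∷ sorted-deleteAt i xs sorted

length-deleteAt : ∀ {A : Set} i (xs : List A) → i < length xs → suc (length (deleteAt i xs)) ≡ length xs
length-deleteAt zero (x ∷ xs) _ = refl
length-deleteAt (suc i) (x ∷ xs) (s≤s i<) = cong suc (length-deleteAt i xs i<)

infix 5 _∈ᵇ_
_∈ᵇ_ : ℕ → List ℕ → Bool
x ∈ᵇ [] = false
x ∈ᵇ (y ∷ ys) = (x ≡ᵇ y) ∨ (x ∈ᵇ ys)

∈ᵇ-++ : ∀ x xs ys → x ∈ᵇ (xs ++ ys) ≡ (x ∈ᵇ xs) ∨ (x ∈ᵇ ys)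
∈ᵇ-++ x [] ys = refl
∈ᵇ-++ x (y ∷ xs) ys = trans (cong ((x ≡ᵇ y) ∨_) (∈ᵇ-++ x xs ys)) (sym (∨-assoc (x ≡ᵇ y) _ _))

∈ᵇ⇒∈ : ∀ {x} xs → x ∈ᵇ xs ≡ true → x ∈ xs
∈ᵇ⇒∈ {x} (y ∷ xs) x∈ᵇ with x ≡ᵇ y in x≡y
... | true = here (≡ᵇ≡true⇒≡ x≡y)
... | false = there (∈ᵇ⇒∈ xs x∈ᵇ)

∈⇒∈ᵇ : ∀ {x xs} → x ∈ xs → x ∈ᵇ xs ≡ true
∈⇒∈ᵇ {x} {_ ∷ xs} (here refl) = cong (_∨ (x ∈ᵇ xs)) (≡⇒≡ᵇ≡true {x} refl)
∈⇒∈ᵇ {x} {y ∷ _} (there x∈) = trans (cong ((x ≡ᵇ y) ∨_) (∈⇒∈ᵇ x∈)) (∨-zeroʳ (x ≡ᵇ y))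

∉ᵇ-All : ∀ {P : ℕ → Set} {x} xs → All P xs → ¬ P x → x ∈ᵇ xs ≡ false
∉ᵇ-All [] [] ¬Px = refl
∉ᵇ-All {P} {x} (y ∷ xs) (Py ∷ Pxs) ¬Px with x ≡ᵇ y in x≡y
... | true = ⊥-elim (¬Px (subst P (sym (≡ᵇ≡true⇒≡ x≡y)) Py))
... | false = ∉ᵇ-All xs Pxs ¬Px

∉ᵇ⇒All≢ : ∀ {x} xs → x ∈ᵇ xs ≡ false → All (_≢ x) xs
∉ᵇ⇒All≢ [] _ = []
∉ᵇ⇒All≢ {x} (y ∷ xs) x∉ with x ≡ᵇ y in x≡y
... | false = (≡ᵇ≡false⇒≢ x≡y ∘ sym) ∷ ∉ᵇ⇒All≢ xs x∉

countFrom-∈ᵇ : ∀ c k J → Sorted J → All (Within c k) J → countFrom (_∈ᵇ J) c k ≡ length J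
countFrom-∈ᵇ c k [] _ _ = countFrom-none _ c k (λ _ _ → refl)
countFrom-∈ᵇ c k (y ∷ J) (y<J ∷ sorted) (ry ∷ rJ) =
  trans (countFrom-∨ (_≡ᵇ y) (_∈ᵇ J) c k disjoint)
        (cong₂ _+_ (countFrom-unique _ c k y ry (≡⇒≡ᵇ≡true {y} refl) (λ x _ → ≡ᵇ≡true⇒≡))
                     (countFrom-∈ᵇ c k J sorted rJ))
  where
  disjoint : ∀ x → Within c k x → (x ≡ᵇ y) ≡ true → x ∈ᵇ J ≡ false
  disjoint x _ x≡y = subst (λ z → z ∈ᵇ J ≡ false) (sym (≡ᵇ≡true⇒≡ x≡y)) (∉ᵇ-All J y<J (<-irrefl refl))

rows : List Vector → List ℕ → List (List ℤ)
rows vs J = map (λ v → map v J) vs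

minor≡wedgeCoeff : ∀ vs j J → det (length vs) (map (dropCol j) (rows vs J)) ≡ wedgeCoeff vs (deleteAt j J)
minor≡wedgeCoeff vs j J = cong (det (length vs)) (rows-dropCol vs)
  where
  dropCol-map : ∀ (v : Vector) j J → dropCol j (map v J) ≡ map v (deleteAt j J)
  dropCol-map v j [] = refl
  dropCol-map v zero (x ∷ J) = refl
  dropCol-map v (suc j) (x ∷ J) = cong (v x ∷_) (dropCol-map v j J)
  rows-dropCol : ∀ vs → map (dropCol j) (rows vs J) ≡ rows vs (deleteAt j J)
  rows-dropCol [] = refl
  rows-dropCol (v ∷ vs) = cong₂ _∷_ (dropCol-map v j J) (rows-dropCol vs)

lap-zeroRow : ∀ k j xs rs → All (_≡ + 0) xs → lap k j xs rs ≡ + 0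
lap-zeroRow k j [] rs [] = refl
lap-zeroRow k j (x ∷ xs) rs (refl ∷ zeros) =
  cong₂ ℤ._+_ (trans (cong (ℤ._* det k (map (dropCol j) rs)) (ℤP.*-zeroʳ (sgn j))) (ℤP.*-zeroˡ (det k (map (dropCol j) rs))))
              (lap-zeroRow k (suc j) xs rs zeros)

lap-zeroMinors : ∀ k j xs rs → (∀ i → j ≤ i → i < j + length xs → det k (map (dropCol i) rs) ≡ + 0) →
  lap k j xs rs ≡ + 0
lap-zeroMinors k j [] rs zeros = refl
lap-zeroMinors k j (x ∷ xs) rs zeros =
  cong₂ ℤ._+_ (trans (cong (sgn j ℤ.* x ℤ.*_) (zeros j ≤-refl (m<m+n j (s≤s z≤n)))) (ℤP.*-zeroʳ (sgn j ℤ.* x)))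
              (lap-zeroMinors k (suc j) xs rs
                (λ i j<i i< → zeros i (<⇒≤ j<i) (subst (i <_) (sym (+-suc j (length xs))) i<)))

lap-++ : ∀ k j xs ys rs → lap k j (xs ++ ys) rs ≡ lap k j xs rs ℤ.+ lap k (j + length xs) ys rs
lap-++ k j [] ys rs = trans (cong (λ j' → lap k j' ys rs) (sym (+-identityʳ j))) (sym (ℤP.+-identityˡ _))
lap-++ k j (x ∷ xs) ys rs = begin
  t ℤ.+ lap k (suc j) (xs ++ ys) rs                                     ≡⟨ cong (ℤ._+_ t) (lap-++ k (suc j) xs ys rs) ⟩
  t ℤ.+ (lap k (suc j) xs rs ℤ.+ lap k (suc j + length xs) ys rs)       ≡⟨ sym (ℤP.+-assoc t _ _) ⟩
  t ℤ.+ lap k (suc j) xs rs ℤ.+ lap k (suc j + length xs) ys rs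
    ≡⟨ cong (λ j' → t ℤ.+ lap k (suc j) xs rs ℤ.+ lap k j' ys rs) (sym (+-suc j (length xs))) ⟩
  t ℤ.+ lap k (suc j) xs rs ℤ.+ lap k (j + suc (length xs)) ys rs       ∎
  where
  open ≡-Reasoning
  t = sgn j ℤ.* x ℤ.* det k (map (dropCol j) rs)

wedgeCoeff-zeroRow : ∀ (f : Vector) vs J → All (λ x → f x ≡ + 0) J → wedgeCoeff (f ∷ vs) J ≡ + 0
wedgeCoeff-zeroRow f vs J zeros = lap-zeroRow (length vs) 0 (map f J) (rows vs J) (Allₚ.map⁺ zeros)

wedgeCoeff-singleEntry : ∀ (f : Vector) vs J₁ y J₂ → All (λ x → f x ≡ + 0) J₁ → All (λ x → f x ≡ + 0) J₂ →
  wedgeCoeff (f ∷ vs) (J₁ ++ y ∷ J₂) ≡ sgn (length J₁) ℤ.* f y ℤ.* wedgeCoeff vs (J₁ ++ J₂)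
wedgeCoeff-singleEntry f vs J₁ y J₂ zeros₁ zeros₂ = begin
  lap k 0 (map f J) R                                        ≡⟨ cong (λ xs → lap k 0 xs R) (map-++ f J₁ (y ∷ J₂)) ⟩
  lap k 0 (map f J₁ ++ f y ∷ map f J₂) R                     ≡⟨ lap-++ k 0 (map f J₁) (f y ∷ map f J₂) R ⟩
  lap k 0 (map f J₁) R ℤ.+ (term ℤ.+ lap k (suc p) (map f J₂) R)
    ≡⟨ cong₂ (λ u v → u ℤ.+ (term ℤ.+ v)) (lap-zeroRow k 0 _ R (Allₚ.map⁺ zeros₁)) (lap-zeroRow k (suc p) _ R (Allₚ.map⁺ zeros₂)) ⟩
  + 0 ℤ.+ (term ℤ.+ + 0)                                     ≡⟨ trans (ℤP.+-identityˡ _) (ℤP.+-identityʳ _) ⟩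
  sgn p ℤ.* f y ℤ.* det k (map (dropCol p) R)                ≡⟨ cong (sgn p ℤ.* f y ℤ.*_) (minor≡wedgeCoeff vs p J) ⟩
  sgn p ℤ.* f y ℤ.* wedgeCoeff vs (deleteAt p J)
    ≡⟨ cong₂ (λ q K → sgn q ℤ.* f y ℤ.* wedgeCoeff vs K) p≡ (trans (cong (λ q → deleteAt q J) p≡) (deleteAt-middle J₁ y J₂)) ⟩
  sgn (length J₁) ℤ.* f y ℤ.* wedgeCoeff vs (J₁ ++ J₂)       ∎
  where
  open ≡-Reasoning
  J = J₁ ++ y ∷ J₂
  k = length vs
  R = rows vs J
  p = length (map f J₁)
  term = sgn p ℤ.* f y ℤ.* det k (map (dropCol p) R)
  p≡ : p ≡ length J₁
  p≡ = length-map f J₁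

wedgeCoeff-head : ∀ (f : Vector) vs x J → (∀ i → i < length J → wedgeCoeff vs (x ∷ deleteAt i J) ≡ + 0) →
  wedgeCoeff (f ∷ vs) (x ∷ J) ≡ f x ℤ.* wedgeCoeff vs J
wedgeCoeff-head f vs x J zeros = begin
  + 1 ℤ.* f x ℤ.* det k (map (dropCol 0) R) ℤ.+ lap k 1 (map f J) R
    ≡⟨ cong₂ ℤ._+_ (cong (ℤ._* det k (map (dropCol 0) R)) (ℤP.*-identityˡ (f x))) (lap-zeroMinors k 1 (map f J) R zeroMinor) ⟩
  f x ℤ.* det k (map (dropCol 0) R) ℤ.+ + 0                   ≡⟨ ℤP.+-identityʳ _ ⟩
  f x ℤ.* det k (map (dropCol 0) R)                           ≡⟨ cong (f x ℤ.*_) (minor≡wedgeCoeff vs 0 (x ∷ J)) ⟩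
  f x ℤ.* wedgeCoeff vs J                                     ∎
  where
  open ≡-Reasoning
  k = length vs
  R = rows vs (x ∷ J)
  zeroMinor : ∀ i → 1 ≤ i → i < 1 + length (map f J) → det k (map (dropCol i) R) ≡ + 0
  zeroMinor (suc i) _ (s≤s i<) = trans (minor≡wedgeCoeff vs (suc i) (x ∷ J)) (zeros i (subst (i <_) (length-map f J) i<))

e-same : ∀ a → e a a ≡ + 1
e-same a = cong (if_then + 1 else + 0) (≡⇒≡ᵇ≡true {a} refl)

e-other : ∀ {a x} → x ≢ a → e a x ≡ + 0
e-other x≢a = cong (if_then + 1 else + 0) (≢⇒≡ᵇ≡false x≢a)

factor-first : ∀ {a b} → a ≢ b → factor (a , b) a ≡ + 1
factor-first {a} {b} a≢b rewrite e-same a | e-other a≢b = cong (ℤ._+_ (+ 1)) (ℤP.*-zeroʳ (sgn (mcount a b)))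

factor-second : ∀ {a b} → a ≢ b → factor (a , b) b ≡ sgn (mcount a b)
factor-second {a} {b} a≢b rewrite e-same b | e-other (a≢b ∘ sym) = trans (ℤP.+-identityˡ _) (ℤP.*-identityʳ _)

factor-elsewhere : ∀ {a b x} → x ≢ a → x ≢ b → factor (a , b) x ≡ + 0
factor-elsewhere {a} {b} x≢a x≢b rewrite e-other x≢a | e-other x≢b = trans (ℤP.+-identityˡ _) (ℤP.*-zeroʳ (sgn (mcount a b)))

sgn*sgn : ∀ p → sgn p ℤ.* sgn p ≡ + 1
sgn*sgn p with isEven p
... | true = refl
... | false = refl

-- The expansion by brackets

_IsIndicatorOf_ : ℤ → Set → Set
w IsIndicatorOf P = (P → w ≡ + 1) × (¬ P → w ≡ + 0)

indicator-resp : ∀ {w w' P Q} → w ≡ w' → P ⇔ Q → w' IsIndicatorOf Q → w IsIndicatorOf P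
indicator-resp refl P⇔Q (if-yes , if-no) = if-yes ∘ Equivalence.to P⇔Q , λ ¬P → if-no (¬P ∘ Equivalence.from P⇔Q)

indicator-absurd : ∀ {w P} → ¬ P → w ≡ + 0 → w IsIndicatorOf P
indicator-absurd ¬P w≡0 = (λ P → ⊥-elim (¬P P)) , (λ _ → w≡0)

indicator-scale : ∀ {s w P} → (P → s ≡ + 1) → w IsIndicatorOf P → (s ℤ.* w) IsIndicatorOf P
indicator-scale {s} s≡1 (if-yes , if-no) =
  (λ P → cong₂ ℤ._*_ (s≡1 P) (if-yes P)) , (λ ¬P → trans (cong (s ℤ.*_) (if-no ¬P)) (ℤP.*-zeroʳ s))

All-strict : ∀ {c} J → All (c ≤_) J → c ∈ᵇ J ≡ false → All (c <_) J
All-strict J c≤J c∉J = All.zipWith (λ (c≤x , x≢c) → ≤∧≢⇒< c≤x (x≢c ∘ sym)) (c≤J , ∉ᵇ⇒All≢ J c∉J)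

module Expansion (N : ℕ) (lab : Labelling) (nc : NonCrossing N lab) (alt : ∀ x → lab x ≢ lab (suc x))
  (gapInFirstBlock : ∀ x → 1 ≤ x → suc x ≤ N → Blocks.isGap N lab x ≡ true → lab x ≡ lab 1) where

  open Blocks N lab
  open Alternating nc alt
  open GapsInFirstBlock gapInFirstBlock

  free : ℕ → List ℕ → ℕ → Bool
  free y J x = sameBlock y x ∧ not (x ∈ᵇ J)

  free-self : ∀ y J → free y J y ≡ not (y ∈ᵇ J)
  free-self y J = cong (_∧ not (y ∈ᵇ J)) (≡⇒≡ᵇ≡true {lab y} refl)

  ConcordantFrom : ℕ → ℕ → List ℕ → Set
  ConcordantFrom c k J = All (c ≤_) J × (∀ y → Within c k y → countFrom (free y J) c k ≡ 1)

  ExpansionFrom : ℕ → ℕ → Set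
  ExpansionFrom c k = ∀ J → Sorted J → All (_≤ N) J → length J ≡ length (bracketsFrom c k) →
    wedgeCoeff (map factor (bracketsFrom c k)) J IsIndicatorOf ConcordantFrom c k J

  expansion-empty : ∀ c → ExpansionFrom c 0
  expansion-empty c [] _ _ _ = (λ _ → refl) , (λ ¬concordant → ⊥-elim (¬concordant ([] , λ y ry → ⊥-elim (within-zero ry))))

  module Step (c k : ℕ) (1≤c : 1 ≤ c) (end : suc c + k ≡ suc N) (IH : ExpansionFrom (suc c) k) where

    L' : List (ℕ × ℕ)
    L' = bracketsFrom (suc c) k

    within⇒≤N : ∀ {y} → Within (suc c) k y → y ≤ N
    within⇒≤N {y} (_ , y<) = ≤-pred (subst (y <_) end y<)

    ≤N⇒within : ∀ {y} → c < y → y ≤ N → Within (suc c) k y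
    ≤N⇒within {y} c<y y≤N = c<y , subst (y <_) (sym end) (s≤s y≤N)

    brackets≡ : ∀ {B} → firstOf c (successors N lab c) ≡ B → bracketsFrom c (suc k) ≡ B ++ L'
    brackets≡ = cong (_++ L')

    module LastOfBlock (noBracket : firstOf c (successors N lab c) ≡ []) (¬later : ∀ y → c < y → y ≤ N → lab c ≢ lab y) where

      otherBlock : ∀ J y → Within (suc c) k y → free y J c ≡ false
      otherBlock J y ry = cong (_∧ not (c ∈ᵇ J)) (≢⇒≡ᵇ≡false (λ eq → ¬later y (proj₁ ry) (within⇒≤N ry) (sym eq)))

      noFreeLater : ∀ J → countFrom (free c J) (suc c) k ≡ 0
      noFreeLater J = countFrom-none _ (suc c) k
        (λ x rx → cong (_∧ not (x ∈ᵇ J)) (≢⇒≡ᵇ≡false (¬later x (proj₁ rx) (within⇒≤N rx))))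

      concordant⇔ : ∀ J → ConcordantFrom c (suc k) J ⇔ ConcordantFrom (suc c) k J
      concordant⇔ J = mk⇔ to from
        where
        to : ConcordantFrom c (suc k) J → ConcordantFrom (suc c) k J
        to (c≤J , count) = All-strict J c≤J c∉J , λ y ry →
          trans (sym (cong (λ s → boolToℕ s + countFrom (free y J) (suc c) k) (otherBlock J y ry))) (count y (within-suc ry))
          where
          c∉J : c ∈ᵇ J ≡ false
          c∉J = not-injective (trans (sym (free-self c J)) (boolToℕ≡1 (begin
            boolToℕ (free c J c)                                       ≡⟨ sym (+-identityʳ _) ⟩
            boolToℕ (free c J c) + 0                                   ≡⟨ cong (_+_ (boolToℕ (free c J c))) (sym (noFreeLater J)) ⟩
            boolToℕ (free c J c) + countFrom (free c J) (suc c) k      ≡⟨ count c (within-first c k) ⟩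
            1                                                          ∎)))
            where open ≡-Reasoning
        from : ConcordantFrom (suc c) k J → ConcordantFrom c (suc k) J
        from (c<J , count) = All-map <⇒≤ c<J , counted
          where
          counted : ∀ y → Within c (suc k) y → countFrom (free y J) c (suc k) ≡ 1
          counted y ry with within-split ry
          ... | inj₁ refl = cong₂ _+_ (cong boolToℕ (trans (free-self c J) (cong not (∉ᵇ-All J c<J (<-irrefl refl))))) (noFreeLater J)
          ... | inj₂ ry' = trans (cong (_+ countFrom (free y J) (suc c) k) (cong boolToℕ (otherBlock J y ry'))) (count y ry')

      expansion : ExpansionFrom c (suc k)
      expansion J sorted bounds len rewrite brackets≡ noBracket = indicator-resp refl (concordant⇔ J) (IH J sorted bounds len)

    module WithNext (b : ℕ) (bracket : firstOf c (successors N lab c) ≡ (c , b) ∷ [])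
      (b-next : IsNext c b) where

      open IsNext b-next renaming (a<b to c<b)

      f : Vector
      f = factor (c , b)

      vs : List Vector
      vs = map factor L'

      rb : Within (suc c) k b
      rb = ≤N⇒within c<b b≤N

      free-c≡b : ∀ J x → free c J x ≡ free b J x
      free-c≡b J x = cong (λ l → (l ≡ᵇ lab x) ∧ not (x ∈ᵇ J)) same

      -- Deleting any later column leaves x ≤ c among the columns, so those minors vanish.
      expandHead : ∀ x J' → x ≤ c → Sorted (x ∷ J') → All (_≤ N) (x ∷ J') → length J' ≡ length L' →
        wedgeCoeff (f ∷ vs) (x ∷ J') ≡ f x ℤ.* wedgeCoeff vs J'
      expandHead x J' x≤c (x<J' ∷ sorted) (x≤N ∷ bounds) len = wedgeCoeff-head f vs x J' vanishing
        where
        vanishing : ∀ i → i < length J' → wedgeCoeff vs (x ∷ deleteAt i J') ≡ + 0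
        vanishing i i< = proj₂ (IH (x ∷ deleteAt i J') (All-deleteAt i J' x<J' ∷ sorted-deleteAt i J' sorted)
                                     (x≤N ∷ All-deleteAt i J' bounds) (trans (length-deleteAt i J' i<) len))
                               (λ { ((c<x ∷ _) , _) → <-irrefl refl (<-≤-trans c<x x≤c) })

      caseBelow : ∀ x J' → x < c → Sorted (x ∷ J') → All (_≤ N) (x ∷ J') → length J' ≡ length L' →
        wedgeCoeff (f ∷ vs) (x ∷ J') IsIndicatorOf ConcordantFrom c (suc k) (x ∷ J')
      caseBelow x J' x<c sorted bounds len =
        indicator-absurd (λ { ((c≤x ∷ _) , _) → <-irrefl refl (<-≤-trans x<c c≤x) }) (begin
          wedgeCoeff (f ∷ vs) (x ∷ J')   ≡⟨ expandHead x J' (<⇒≤ x<c) sorted bounds len ⟩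
          f x ℤ.* wedgeCoeff vs J'       ≡⟨ cong (ℤ._* wedgeCoeff vs J') (factor-elsewhere (<⇒≢ x<c) (<⇒≢ (<-trans x<c c<b))) ⟩
          + 0 ℤ.* wedgeCoeff vs J'       ≡⟨ ℤP.*-zeroˡ (wedgeCoeff vs J') ⟩
          + 0                            ∎)
        where open ≡-Reasoning

      caseAt : ∀ J' → Sorted (c ∷ J') → All (_≤ N) (c ∷ J') → length J' ≡ length L' →
        wedgeCoeff (f ∷ vs) (c ∷ J') IsIndicatorOf ConcordantFrom c (suc k) (c ∷ J')
      caseAt J' sorted@(c<J' ∷ sorted') bounds@(_ ∷ bounds') len =
        indicator-resp (trans (expandHead c J' ≤-refl sorted bounds len)
                              (trans (cong (ℤ._* wedgeCoeff vs J') (factor-first (<⇒≢ c<b))) (ℤP.*-identityˡ _)))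
                       concordant⇔ (IH J' sorted' bounds' len)
        where
        taken : ∀ y → free y (c ∷ J') c ≡ false
        taken y = trans (cong (λ m → sameBlock y c ∧ not (m ∨ (c ∈ᵇ J'))) (≡⇒≡ᵇ≡true {c} refl)) (∧-zeroʳ (sameBlock y c))
        later≡ : ∀ y → countFrom (free y (c ∷ J')) (suc c) k ≡ countFrom (free y J') (suc c) k
        later≡ y = sumFrom-cong (suc c) k (λ x rx → cong (λ m → boolToℕ (sameBlock y x ∧ not (m ∨ (x ∈ᵇ J'))))
                                                       (≢⇒≡ᵇ≡false (<⇒≢ (proj₁ rx) ∘ sym)))
        split : ∀ y → countFrom (free y (c ∷ J')) c (suc k) ≡ countFrom (free y J') (suc c) k
        split y = trans (cong (λ z → boolToℕ z + countFrom (free y (c ∷ J')) (suc c) k) (taken y)) (later≡ y)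
        concordant⇔ : ConcordantFrom c (suc k) (c ∷ J') ⇔ ConcordantFrom (suc c) k J'
        concordant⇔ = mk⇔ (λ (_ , count) → c<J' , λ y ry → trans (sym (split y)) (count y (within-suc ry)))
                          (λ (_ , count) → ≤-refl ∷ All-map <⇒≤ c<J' , counted count)
          where
          counted : (∀ y → Within (suc c) k y → countFrom (free y J') (suc c) k ≡ 1) →
            ∀ y → Within c (suc k) y → countFrom (free y (c ∷ J')) c (suc k) ≡ 1
          counted count y ry with within-split ry
          ... | inj₁ refl = trans (split c) (trans (sumFrom-cong (suc c) k (λ x _ → cong boolToℕ (free-c≡b J' x))) (count b rb))
          ... | inj₂ ry' = trans (split y) (count y ry')

      caseWithoutB : ∀ J → All (c <_) J → b ∈ᵇ J ≡ false →
        wedgeCoeff (f ∷ vs) J IsIndicatorOf ConcordantFrom c (suc k) J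
      caseWithoutB J c<J b∉J = indicator-absurd ¬concordant
        (wedgeCoeff-zeroRow f vs J (All.zipWith (λ (c<x , x≢b) → factor-elsewhere (<⇒≢ c<x ∘ sym) x≢b) (c<J , ∉ᵇ⇒All≢ J b∉J)))
        where
        c∉J : c ∈ᵇ J ≡ false
        c∉J = ∉ᵇ-All J c<J (<-irrefl refl)
        ¬concordant : ¬ ConcordantFrom c (suc k) J
        ¬concordant (_ , count) = <-irrefl (sym (count c (within-first c k)))
          (countFrom-two (free c J) c (suc k) c b (within-first c k) (within-suc rb) c<b
            (trans (free-self c J) (cong not c∉J)) (cong₂ (λ s m → s ∧ not m) (≡⇒≡ᵇ≡true same) b∉J))

      module Middle (J₁ J₂ : List ℕ) (sorted : Sorted (J₁ ++ b ∷ J₂)) (bounds : All (_≤ N) (J₁ ++ b ∷ J₂))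
        (len : length (J₁ ++ b ∷ J₂) ≡ suc (length L')) (c<J : All (c <_) (J₁ ++ b ∷ J₂)) where

        J K : List ℕ
        J = J₁ ++ b ∷ J₂
        K = J₁ ++ J₂

        J₁<b : All (_< b) J₁
        J₁<b = proj₁ (sorted-middle J₁ b J₂ sorted)

        b<J₂ : All (b <_) J₂
        b<J₂ = proj₁ (proj₂ (sorted-middle J₁ b J₂ sorted))

        sortedK : Sorted K
        sortedK = proj₂ (proj₂ (sorted-middle J₁ b J₂ sorted))

        dropMiddle : ∀ {P : ℕ → Set} → All P J → All P K
        dropMiddle PJ with Allₚ.++⁻ J₁ PJ
        ... | PJ₁ , _ ∷ PJ₂ = Allₚ.++⁺ PJ₁ PJ₂

        lenK : length K ≡ length L'
        lenK = suc-injective (trans (sym (length-++-sucʳ J₁ b J₂)) len)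

        b∉K : b ∈ᵇ K ≡ false
        b∉K = trans (∈ᵇ-++ b J₁ J₂) (cong₂ _∨_ (∉ᵇ-All J₁ J₁<b (<-irrefl refl)) (∉ᵇ-All J₂ b<J₂ (<-irrefl refl)))

        b∈J : b ∈ᵇ J ≡ true
        b∈J = ∈⇒∈ᵇ (∈-insert J₁)

        ∈ᵇJ≡∈ᵇK : ∀ x → x ≢ b → x ∈ᵇ J ≡ x ∈ᵇ K
        ∈ᵇJ≡∈ᵇK x x≢b = trans (∈ᵇ-++ x J₁ (b ∷ J₂))
          (trans (cong (λ m → (x ∈ᵇ J₁) ∨ (m ∨ (x ∈ᵇ J₂))) (≢⇒≡ᵇ≡false x≢b)) (sym (∈ᵇ-++ x J₁ J₂)))

        freeK : ∀ y x → boolToℕ (free y K x) ≡ boolToℕ (free y J x) + boolToℕ ((x ≡ᵇ b) ∧ sameBlock y x)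
        freeK y x with x ≟ b
        ... | no x≢b rewrite ≢⇒≡ᵇ≡false x≢b | ∈ᵇJ≡∈ᵇK x x≢b = sym (+-identityʳ _)
        ... | yes refl rewrite ≡⇒≡ᵇ≡true {b} refl | b∉K | b∈J with sameBlock y b
        ...   | true = refl
        ...   | false = refl

        countK : ∀ y → countFrom (free y K) (suc c) k ≡ countFrom (free y J) (suc c) k + boolToℕ (sameBlock y b)
        countK y = trans (sumFrom-cong (suc c) k (λ x _ → freeK y x))
          (trans (sumFrom-distrib-+ _ _ (suc c) k) (cong (_+_ (countFrom (free y J) (suc c) k)) (countFrom-≡ᵇ (sameBlock y) b (suc c) k rb)))

        freeAt-c : ∀ y → free y J c ≡ sameBlock y b
        freeAt-c y = trans (cong (λ m → sameBlock y c ∧ not m) (∉ᵇ-All J c<J (<-irrefl refl)))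
                           (trans (∧-identityʳ (sameBlock y c)) (cong (lab y ≡ᵇ_) same))

        countJ : ∀ y → countFrom (free y J) c (suc k) ≡ countFrom (free y K) (suc c) k
        countJ y = trans (cong (λ z → boolToℕ z + countFrom (free y J) (suc c) k) (freeAt-c y))
                         (trans (+-comm (boolToℕ (sameBlock y b)) _) (sym (countK y)))

        concordant⇔ : ConcordantFrom c (suc k) J ⇔ ConcordantFrom (suc c) k K
        concordant⇔ = mk⇔ (λ (_ , count) → dropMiddle c<J , λ y ry → trans (sym (countJ y)) (count y (within-suc ry)))
                          (λ (_ , count) → All-map <⇒≤ c<J , counted count)
          where
          counted : (∀ y → Within (suc c) k y → countFrom (free y K) (suc c) k ≡ 1) →
            ∀ y → Within c (suc k) y → countFrom (free y J) c (suc k) ≡ 1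
          counted count y ry with within-split ry
          ... | inj₁ refl = begin
            boolToℕ (free c J c) + countFrom (free c J) (suc c) k
              ≡⟨ cong₂ (λ s r → boolToℕ s + r) (freeAt-c c) (sumFrom-cong (suc c) k (λ x _ → cong boolToℕ (free-c≡b J x))) ⟩
            boolToℕ (sameBlock c b) + countFrom (free b J) (suc c) k
              ≡⟨ cong (λ s → boolToℕ s + countFrom (free b J) (suc c) k) (≡⇒≡ᵇ≡true same) ⟩
            1 + countFrom (free b J) (suc c) k                         ≡⟨ cong suc noFreeAfterB ⟩
            1                                                          ∎
            where
            open ≡-Reasoning
            noFreeAfterB : countFrom (free b J) (suc c) k ≡ 0
            noFreeAfterB = +-cancelʳ-≡ 1 _ 0 (trans (cong (_+_ (countFrom (free b J) (suc c) k)) (sym (cong boolToℕ (≡⇒≡ᵇ≡true {lab b} refl))))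
                                                    (trans (sym (countK b)) (count b rb)))
          ... | inj₂ ry' = trans (countJ y) (count y ry')

        inner : ℕ
        inner = b ∸ suc c

        inner≤k : inner ≤ k
        inner≤k = +-cancelˡ-≤ (suc c) inner k
          (≤-trans (≤-reflexive (m+[n∸m]≡n c<b)) (≤-trans b≤N (≤-trans (n≤1+n N) (≤-reflexive (sym end)))))

        inner-closed : BlockClosed (suc c) inner
        inner-closed = nextInterval-closed 1≤c b-next

        inner-bounds : InBounds (suc c) inner
        inner-bounds = s≤s z≤n , ≤-trans (≤-reflexive (m+[n∸m]≡n c<b)) (≤-trans b≤N (n≤1+n N))

        restrict : ConcordantFrom (suc c) k K → OneInEachClass sameBlock (λ x → not (x ∈ᵇ K)) (suc c) inner
        restrict (_ , count) y ry = begin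
          countFrom (free y K) (suc c) inner                                          ≡⟨ sym (+-identityʳ _) ⟩
          countFrom (free y K) (suc c) inner + 0                                      ≡⟨ cong (_+_ (countFrom (free y K) (suc c) inner)) (sym beyond) ⟩
          countFrom (free y K) (suc c) inner + countFrom (free y K) (suc c + inner) (k ∸ inner) ≡⟨ sym (sumFrom-+ _ (suc c) inner (k ∸ inner)) ⟩
          countFrom (free y K) (suc c) (inner + (k ∸ inner))                          ≡⟨ cong (countFrom (free y K) (suc c)) (m+[n∸m]≡n inner≤k) ⟩
          countFrom (free y K) (suc c) k                                              ≡⟨ count y (within-≤ inner≤k ry) ⟩
          1                                                                           ∎
          where
          open ≡-Reasoning
          beyond : countFrom (free y K) (suc c + inner) (k ∸ inner) ≡ 0
          beyond = countFrom-none _ _ _ notSame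
            where
            notSame : ∀ x → Within (suc c + inner) (k ∸ inner) x → free y K x ≡ false
            notSame x (b≤x , x<) with sameBlock y x in y~x
            ... | false = refl
            ... | true = ⊥-elim (<-irrefl refl (<-≤-trans (proj₂ (inner-closed y x ry 1≤x x≤N (≡ᵇ≡true⇒≡ y~x))) b≤x))
              where
              1≤x : 1 ≤ x
              1≤x = ≤-trans (s≤s z≤n) b≤x
              x≤N : x ≤ N
              x≤N = ≤-pred (subst (x <_) (trans (+-assoc (suc c) inner (k ∸ inner)) (trans (cong (_+_ (suc c)) (m+[n∸m]≡n inner≤k)) end)) x<)

        membersInside : countFrom (_∈ᵇ K) (suc c) inner ≡ length J₁
        membersInside = trans (sumFrom-cong (suc c) inner onlyJ₁)
          (countFrom-∈ᵇ (suc c) inner J₁ (sorted-++⁻ˡ J₁ sortedK)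
            (All.zipWith (λ (c<x , x<b) → within-between c<x x<b) (Allₚ.++⁻ˡ J₁ c<J , J₁<b)))
          where
          onlyJ₁ : ∀ x → Within (suc c) inner x → boolToℕ (x ∈ᵇ K) ≡ boolToℕ (x ∈ᵇ J₁)
          onlyJ₁ x rx = cong boolToℕ (trans (∈ᵇ-++ x J₁ J₂)
            (trans (cong ((x ∈ᵇ J₁) ∨_) (∉ᵇ-All J₂ b<J₂ (λ b<x → <-asym b<x (proj₂ (between-within c<b rx))))) (∨-identityʳ _)))

        -- The sign of the expansion term is cancelled by the sign in the factor.
        sizeJ₁ : ConcordantFrom (suc c) k K → length J₁ ≡ mcount c b
        sizeJ₁ concordant = begin
          length J₁                          ≡⟨ sym membersInside ⟩
          countFrom (_∈ᵇ K) (suc c) inner    ≡⟨ countFrom≡countNext (_∈ᵇ K) (suc c) inner inner-bounds inner-closed (restrict concordant) ⟩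
          countFrom hasNext (suc c) inner    ≡⟨ sym (trans (cong (mcount c) (sym (nextInterval-count 1≤c b-next))) (mcount-gap c _)) ⟩
          mcount c b                         ∎
          where open ≡-Reasoning

        result : wedgeCoeff (f ∷ vs) J IsIndicatorOf ConcordantFrom c (suc k) J
        result = indicator-resp expandB concordant⇔
          (indicator-scale (λ concordant → trans (cong (λ p → sgn p ℤ.* sgn (mcount c b)) (sizeJ₁ concordant)) (sgn*sgn (mcount c b)))
                           (IH K sortedK (dropMiddle bounds) lenK))
          where
          zeros₁ : All (λ x → f x ≡ + 0) J₁
          zeros₁ = All.zipWith (λ (c<x , x<b) → factor-elsewhere (<⇒≢ c<x ∘ sym) (<⇒≢ x<b)) (Allₚ.++⁻ˡ J₁ c<J , J₁<b)
          zeros₂ : All (λ x → f x ≡ + 0) J₂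
          zeros₂ = All-map (λ b<x → factor-elsewhere (<⇒≢ (<-trans c<b b<x) ∘ sym) (<⇒≢ b<x ∘ sym)) b<J₂
          expandB : wedgeCoeff (f ∷ vs) J ≡ sgn (length J₁) ℤ.* sgn (mcount c b) ℤ.* wedgeCoeff vs K
          expandB = trans (wedgeCoeff-singleEntry f vs J₁ b J₂ zeros₁ zeros₂)
                          (cong (λ s → sgn (length J₁) ℤ.* s ℤ.* wedgeCoeff vs K) (factor-second (<⇒≢ c<b)))

      caseAbove : ∀ J → Sorted J → All (_≤ N) J → length J ≡ suc (length L') → All (c <_) J →
        wedgeCoeff (f ∷ vs) J IsIndicatorOf ConcordantFrom c (suc k) J
      caseAbove J sorted bounds len c<J with b ∈ᵇ J in b∈J
      ... | false = caseWithoutB J c<J b∈J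
      ... | true with ∈-∃++ (∈ᵇ⇒∈ J b∈J)
      ...   | J₁ , J₂ , refl = Middle.result J₁ J₂ sorted bounds len c<J

      expansion : ExpansionFrom c (suc k)
      expansion J sorted bounds len rewrite brackets≡ bracket with J | sorted | bounds | len
      ... | x ∷ J' | sorted'@(x<J' ∷ _) | bounds' | len' with <-cmp x c
      ...   | tri< x<c _ _ = caseBelow x J' x<c sorted' bounds' (suc-injective len')
      ...   | tri≈ _ refl _ = caseAt J' sorted' bounds' (suc-injective len')
      ...   | tri> _ _ c<x = caseAbove (x ∷ J') sorted' bounds' len' (c<x ∷ All-map (<-trans c<x) x<J')

    expansionStep : ExpansionFrom c (suc k)
    expansionStep with nextView c
    ... | last _ noBracket ¬later = LastOfBlock.expansion noBracket ¬later
    ... | next b _ bracket b-next = WithNext.expansion b bracket b-next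

  expansion : ∀ k c → 1 ≤ c → c + k ≡ suc N → ExpansionFrom c k
  expansion zero c _ _ = expansion-empty c
  expansion (suc k) c 1≤c end = Step.expansionStep c k 1≤c end' (expansion k (suc c) (s≤s z≤n) end')
    where
    end' : suc c + k ≡ suc N
    end' = trans (sym (+-suc c k)) end

-- Duality

module JoinBlocks (N : ℕ) (lab : Labelling) (nc : NonCrossing N lab) (u v : ℕ) (1≤u : 1 ≤ u) (u<v : u < v) (v≤N : v ≤ N)
  (inside : ∀ y x → u < y → y < v → 1 ≤ x → x ≤ N → lab y ≡ lab x → u < x × x < v) where

  joined : Labelling
  joined p = if lab p ≡ᵇ lab v then lab u else lab p

  InJoined : ℕ → Set
  InJoined x = lab x ≡ lab u ⊎ lab x ≡ lab v

  inJoined? : ∀ x → InJoined x ⊎ ¬ InJoined x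
  inJoined? x with lab x ≟ lab u | lab x ≟ lab v
  ... | yes x~u | _ = inj₁ (inj₁ x~u)
  ... | no _ | yes x~v = inj₁ (inj₂ x~v)
  ... | no x≁u | no x≁v = inj₂ λ { (inj₁ x~u) → x≁u x~u ; (inj₂ x~v) → x≁v x~v }

  joined-inJoined : ∀ {x} → InJoined x → joined x ≡ lab u
  joined-inJoined {x} m with lab x ≡ᵇ lab v in x~v
  ... | true = refl
  ... | false with m
  ...   | inj₁ x~u = x~u
  ...   | inj₂ x~v' = ⊥-elim (≡ᵇ≡false⇒≢ x~v x~v')

  joined-cong : ∀ {a b} → lab a ≡ lab b → joined a ≡ joined b
  joined-cong {a} {b} a~b rewrite a~b = refl

  joined⇒ : ∀ a c → joined a ≡ joined c → lab a ≡ lab c ⊎ (InJoined a × InJoined c)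
  joined⇒ a c eq with lab a ≡ᵇ lab v in a~v | lab c ≡ᵇ lab v in c~v
  ... | true | true = inj₁ (trans (≡ᵇ≡true⇒≡ a~v) (sym (≡ᵇ≡true⇒≡ c~v)))
  ... | true | false = inj₂ (inj₂ (≡ᵇ≡true⇒≡ a~v) , inj₁ (sym eq))
  ... | false | true = inj₂ (inj₁ eq , inj₂ (≡ᵇ≡true⇒≡ c~v))
  ... | false | false = inj₁ eq

  notInside : ∀ x → u < x → x < v → ¬ InJoined x
  notInside x u<x x<v (inj₁ x~u) = <-irrefl refl (proj₁ (inside x u u<x x<v 1≤u (≤-trans (<⇒≤ u<v) v≤N) x~u))
  notInside x u<x x<v (inj₂ x~v) = <-irrefl refl (proj₂ (inside x v u<x x<v (≤-trans 1≤u (<⇒≤ u<v)) v≤N x~v))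

  data Position (x : ℕ) : Set where
    left : x < u → Position x
    atU : x ≡ u → Position x
    inner : u < x → x < v → Position x
    atV : x ≡ v → Position x
    right : v < x → Position x

  position : ∀ x → Position x
  position x with <-cmp x u
  ... | tri< x<u _ _ = left x<u
  ... | tri≈ _ x≡u _ = atU x≡u
  ... | tri> _ _ u<x with <-cmp x v
  ...   | tri< x<v _ _ = inner u<x x<v
  ...   | tri≈ _ x≡v _ = atV x≡v
  ...   | tri> _ _ v<x = right v<x

  ¬InJoined⇒≢u : ∀ {x} → ¬ InJoined x → x ≢ u
  ¬InJoined⇒≢u notIn refl = notIn (inj₁ refl)

  ¬InJoined⇒≢v : ∀ {x} → ¬ InJoined x → x ≢ v
  ¬InJoined⇒≢v notIn refl = notIn (inj₂ refl)

  ¬cross-joinedOuter : ∀ {a b c d} → 1 ≤ a → a < b → b < c → c < d → d ≤ N →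
    InJoined a → InJoined c → lab a ≢ lab c → lab b ≡ lab d → ¬ InJoined b → ⊥
  ¬cross-joinedOuter {a} {b} {c} {d} 1≤a a<b b<c c<d d≤N ja jc a≁c b~d notInB = go (position b) (position c) ja jc
    where
    notInD : ¬ InJoined d
    notInD (inj₁ d~u) = notInB (inj₁ (trans b~d d~u))
    notInD (inj₂ d~v) = notInB (inj₂ (trans b~d d~v))
    1≤b : 1 ≤ b
    1≤b = ≤-trans 1≤a (<⇒≤ a<b)
    go : Position b → Position c → InJoined a → InJoined c → ⊥
    go _ (inner u<c c<v) _ jc' = notInside c u<c c<v jc'
    go (inner u<b b<v) _ _ jc' with inside b d u<b b<v (≤-trans 1≤b (<⇒≤ (<-trans b<c c<d))) d≤N b~d
    ... | u<d , d<v = notInside c (<-trans u<b b<c) (<-trans c<d d<v) jc'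
    go (atU b≡u) _ _ _ = ¬InJoined⇒≢u notInB b≡u
    go (atV b≡v) _ _ _ = ¬InJoined⇒≢v notInB b≡v
    go (left b<u) _ (inj₁ a~u) (inj₁ c~u) = a≁c (trans a~u (sym c~u))
    go (left b<u) _ (inj₂ a~v) (inj₂ c~v) = a≁c (trans a~v (sym c~v))
    go (left b<u) _ (inj₁ a~u) (inj₂ c~v) with <-cmp d u
    ... | tri< d<u _ _ = notInB (inj₂ (trans (nc b c d v 1≤b b<c c<d (<-trans d<u u<v) v≤N b~d c~v) c~v))
    ... | tri≈ _ d≡u _ = ¬InJoined⇒≢u notInD d≡u
    ... | tri> _ _ u<d = notInB (inj₁ (trans (sym (nc a b u d 1≤a a<b b<u u<d d≤N a~u b~d)) a~u))
    go (left b<u) _ (inj₂ a~v) (inj₁ c~u) with <-cmp d v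
    ... | tri≈ _ d≡v _ = ¬InJoined⇒≢v notInD d≡v
    ... | tri> _ _ v<d = notInB (inj₂ (trans (sym (nc a b v d 1≤a a<b (<-trans b<u u<v) v<d d≤N a~v b~d)) a~v))
    ... | tri< d<v _ _ with <-cmp d u
    ...   | tri< d<u _ _ = notInB (inj₁ (trans (nc b c d u 1≤b b<c c<d d<u (≤-trans (<⇒≤ u<v) v≤N) b~d c~u) c~u))
    ...   | tri≈ _ d≡u _ = ¬InJoined⇒≢u notInD d≡u
    ...   | tri> _ _ u<d = <-irrefl refl (<-trans (proj₁ (inside d b u<d d<v 1≤b (≤-trans (<⇒≤ b<u) (≤-trans (<⇒≤ u<v) v≤N)) (sym b~d))) b<u)
    go (right v<b) _ (inj₁ a~u) (inj₁ c~u) = a≁c (trans a~u (sym c~u))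
    go (right v<b) _ (inj₂ a~v) (inj₂ c~v) = a≁c (trans a~v (sym c~v))
    go (right v<b) _ (inj₁ a~u) (inj₂ c~v) = notInB (inj₂ (sym (nc v b c d (≤-trans 1≤u (<⇒≤ u<v)) v<b b<c c<d d≤N (sym c~v) b~d)))
    go (right v<b) _ (inj₂ a~v) (inj₁ c~u) = notInB (inj₁ (sym (nc u b c d 1≤u (<-trans u<v v<b) b<c c<d d≤N (sym c~u) b~d)))

  ¬cross-joinedInner : ∀ {a b c d} → 1 ≤ a → a < b → b < c → c < d → d ≤ N →
    InJoined b → InJoined d → lab b ≢ lab d → lab a ≡ lab c → ¬ InJoined a → ⊥
  ¬cross-joinedInner {a} {b} {c} {d} 1≤a a<b b<c c<d d≤N jb jd b≁d a~c notInA = go (position a) (position c) jb jd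
    where
    notInC : ¬ InJoined c
    notInC (inj₁ c~u) = notInA (inj₁ (trans a~c c~u))
    notInC (inj₂ c~v) = notInA (inj₂ (trans a~c c~v))
    1≤c : 1 ≤ c
    1≤c = ≤-trans 1≤a (<⇒≤ (<-trans a<b b<c))
    c≤N : c ≤ N
    c≤N = ≤-trans (<⇒≤ c<d) d≤N
    go : Position a → Position c → InJoined b → InJoined d → ⊥
    go (inner u<a a<v) _ jb' _ with inside a c u<a a<v 1≤c c≤N a~c
    ... | u<c , c<v = notInside b (<-trans u<a a<b) (<-trans b<c c<v) jb'
    go _ (inner u<c c<v) jb' _ with inside c a u<c c<v 1≤a (≤-trans (<⇒≤ (<-trans a<b b<c)) c≤N) (sym a~c)
    ... | u<a , a<v = notInside b (<-trans u<a a<b) (<-trans b<c c<v) jb'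
    go (atU a≡u) _ _ _ = ¬InJoined⇒≢u notInA a≡u
    go (atV a≡v) _ _ _ = ¬InJoined⇒≢v notInA a≡v
    go _ (atU c≡u) _ _ = ¬InJoined⇒≢u notInC c≡u
    go _ (atV c≡v) _ _ = ¬InJoined⇒≢v notInC c≡v
    go _ _ (inj₁ b~u) (inj₁ d~u) = b≁d (trans b~u (sym d~u))
    go _ _ (inj₂ b~v) (inj₂ d~v) = b≁d (trans b~v (sym d~v))
    go (right v<a) _ (inj₁ b~u) (inj₂ d~v) = notInA (inj₁ (sym (nc u a b c 1≤u (<-trans u<v v<a) a<b b<c c≤N (sym b~u) a~c)))
    go (left a<u) (right v<c) (inj₁ b~u) (inj₂ d~v) = notInA (inj₂ (nc a v c d 1≤a (<-trans a<u u<v) v<c c<d d≤N a~c (sym d~v)))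
    go (left a<u) (left c<u) (inj₁ b~u) (inj₂ d~v) = notInA (inj₁ (trans (nc a b c u 1≤a a<b b<c c<u (≤-trans (<⇒≤ u<v) v≤N) a~c b~u) b~u))
    go (right v<a) _ (inj₂ b~v) (inj₁ d~u) = notInA (inj₂ (sym (nc v a b c (≤-trans 1≤u (<⇒≤ u<v)) v<a a<b b<c c≤N (sym b~v) a~c)))
    go (left a<u) (right v<c) (inj₂ b~v) (inj₁ d~u) = notInA (inj₁ (nc a u c d 1≤a a<u (<-trans u<v v<c) c<d d≤N a~c (sym d~u)))
    go (left a<u) (left c<u) (inj₂ b~v) (inj₁ d~u) = notInA (inj₂ (trans (nc a b c v 1≤a a<b b<c (<-trans c<u u<v) v≤N a~c b~v) b~v))

  joined-nonCrossing : NonCrossing N joined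
  joined-nonCrossing a b c d 1≤a a<b b<c c<d d≤N a≈c b≈d with joined⇒ a c a≈c | joined⇒ b d b≈d
  ... | inj₁ a~c | inj₁ b~d = joined-cong (nc a b c d 1≤a a<b b<c c<d d≤N a~c b~d)
  ... | inj₂ (ja , _) | inj₂ (jb , _) = trans (joined-inJoined ja) (sym (joined-inJoined jb))
  ... | inj₂ (ja , jc) | inj₁ b~d with inJoined? b
  ...   | inj₁ jb = trans (joined-inJoined ja) (sym (joined-inJoined jb))
  ...   | inj₂ notInB with lab a ≟ lab c
  ...     | yes a~c = joined-cong (nc a b c d 1≤a a<b b<c c<d d≤N a~c b~d)
  ...     | no a≁c = ⊥-elim (¬cross-joinedOuter 1≤a a<b b<c c<d d≤N ja jc a≁c b~d notInB)
  joined-nonCrossing a b c d 1≤a a<b b<c c<d d≤N a≈c b≈d | inj₁ a~c | inj₂ (jb , jd) with inJoined? a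
  ...   | inj₁ ja = trans (joined-inJoined ja) (sym (joined-inJoined jb))
  ...   | inj₂ notInA with lab b ≟ lab d
  ...     | yes b~d = joined-cong (nc a b c d 1≤a a<b b<c c<d d≤N a~c b~d)
  ...     | no b≁d = ⊥-elim (¬cross-joinedInner 1≤a a<b b<c c<d d≤N jb jd b≁d a~c notInA)

nonCrossing-≗ : ∀ {N} {lab lab' : Labelling} → (∀ p → lab p ≡ lab' p) → NonCrossing N lab' → NonCrossing N lab
nonCrossing-≗ lab≗lab' nc' a b c d 1≤a a<b b<c c<d d≤N a~c b~d =
  trans (lab≗lab' a) (trans (nc' a b c d 1≤a a<b b<c c<d d≤N (trans (sym (lab≗lab' a)) (trans a~c (lab≗lab' c)))
                                                          (trans (sym (lab≗lab' b)) (trans b~d (lab≗lab' d))))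
                            (sym (lab≗lab' b)))

isEven-2* : ∀ s → isEven (2 * s) ≡ true
isEven-2* zero = refl
isEven-2* (suc s) rewrite +-identityʳ s | +-suc s s =
  trans (not-involutive (isEven (s + s))) (subst (λ m → isEven m ≡ true) (cong (_+_ s) (+-identityʳ s)) (isEven-2* s))

2*⌊n/2⌋≡n : ∀ u → isEven u ≡ true → 2 * ⌊ u /2⌋ ≡ u
2*⌊n/2⌋≡n zero _ = refl
2*⌊n/2⌋≡n (suc (suc u)) even = trans (*-suc 2 ⌊ u /2⌋) (cong (_+_ 2) (2*⌊n/2⌋≡n u (trans (sym (not-involutive (isEven u))) even)))

merge-even : ∀ σ τ {p} → isEven p ≡ true → merge σ τ p ≡ suc (2 * τ ⌊ p /2⌋)
merge-even σ τ even rewrite even = refl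

merge-odd : ∀ σ τ {p} → isEven p ≡ false → merge σ τ p ≡ 2 * σ ⌊ suc p /2⌋
merge-odd σ τ odd rewrite odd = refl

isEven-merge : ∀ σ τ p → isEven (merge σ τ p) ≡ not (isEven p)
isEven-merge σ τ p with isEven p in parity
... | true = cong not (isEven-2* (τ ⌊ p /2⌋))
... | false = isEven-2* (σ ⌊ suc p /2⌋)

merge-alternates : ∀ σ τ x → merge σ τ x ≢ merge σ τ (suc x)
merge-alternates σ τ x same = not-¬ refl (trans (sym (isEven-merge σ τ x)) (trans (cong isEven same) (isEven-merge σ τ (suc x))))

merge-sameParity : ∀ σ τ {x y} → merge σ τ x ≡ merge σ τ y → isEven x ≡ isEven y
merge-sameParity σ τ {x} {y} same = not-injective (trans (sym (isEven-merge σ τ x)) (trans (cong isEven same) (isEven-merge σ τ y)))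

⌊n/2⌋-inRange : ∀ n u → isEven u ≡ true → 1 ≤ u → u ≤ 2 * n → InRange n ⌊ u /2⌋
⌊n/2⌋-inRange n u even 1≤u u≤2n = 1≤h , *-cancelˡ-≤ 2 (≤-trans (≤-reflexive (2*⌊n/2⌋≡n u even)) u≤2n)
  where
  1≤h : 1 ≤ ⌊ u /2⌋
  1≤h with ⌊ u /2⌋ in h
  ... | suc _ = s≤s z≤n
  ... | zero = ⊥-elim (<-irrefl (trans (cong (2 *_) (sym h)) (2*⌊n/2⌋≡n u even)) 1≤u)

module MergedDual (n : ℕ) (σ τ : Labelling) (dual : IsDual n σ τ) where

  N : ℕ
  N = 2 * n

  lab : Labelling
  lab = merge σ τ

  open Blocks N lab

  -- Joining the τ-blocks of two tilde points u < v keeps (σ|τ) non-crossing when the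
  -- points strictly between them form a union of blocks, so maximality of τ forces u ~ v.
  evenEnds-sameBlock : ∀ {u v} → 1 ≤ u → u < v → v ≤ N → isEven u ≡ true → isEven v ≡ true →
    (∀ y x → u < y → y < v → 1 ≤ x → x ≤ N → lab y ≡ lab x → u < x × x < v) → lab u ≡ lab v
  evenEnds-sameBlock {u} {v} 1≤u u<v v≤N even-u even-v inside =
    trans (merge-even σ τ even-u) (trans (cong (λ t → suc (2 * t)) τu≡τv) (sym (merge-even σ τ even-v)))
    where
    open JoinBlocks N lab (proj₁ dual) u v 1≤u u<v v≤N inside
    hu = ⌊ u /2⌋
    hv = ⌊ v /2⌋
    τ' : Labelling
    τ' q = if τ q ≡ᵇ τ hv then τ hu else τ q
    joinedOdd : ∀ {p} → isEven p ≡ false → merge σ τ' p ≡ joined p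
    joinedOdd {p} odd = begin
      merge σ τ' p                  ≡⟨ merge-odd σ τ' odd ⟩
      2 * σ ⌊ suc p /2⌋             ≡⟨ sym (merge-odd σ τ odd) ⟩
      lab p                         ≡⟨ sym (cong (if_then lab u else lab p) (≢⇒≡ᵇ≡false p≁v)) ⟩
      joined p                      ∎
      where
      open ≡-Reasoning
      p≁v : lab p ≢ lab v
      p≁v p~v = not-¬ refl (trans (sym odd) (trans (merge-sameParity σ τ p~v) even-v))
    joinedEven : ∀ {p} → isEven p ≡ true → merge σ τ' p ≡ joined p
    joinedEven {p} even with τ ⌊ p /2⌋ ≟ τ hv
    ... | yes same = begin
      merge σ τ' p                  ≡⟨ merge-even σ τ' even ⟩
      suc (2 * τ' ⌊ p /2⌋)          ≡⟨ cong (λ b → suc (2 * (if b then τ hu else τ ⌊ p /2⌋))) (≡⇒≡ᵇ≡true same) ⟩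
      suc (2 * τ hu)                ≡⟨ sym (merge-even σ τ even-u) ⟩
      lab u                         ≡⟨ sym (cong (if_then lab u else lab p) (≡⇒≡ᵇ≡true p~v)) ⟩
      joined p                      ∎
      where
      open ≡-Reasoning
      p~v : lab p ≡ lab v
      p~v = trans (merge-even σ τ even) (trans (cong (λ t → suc (2 * t)) same) (sym (merge-even σ τ even-v)))
    ... | no differ = begin
      merge σ τ' p                  ≡⟨ merge-even σ τ' even ⟩
      suc (2 * τ' ⌊ p /2⌋)          ≡⟨ cong (λ b → suc (2 * (if b then τ hu else τ ⌊ p /2⌋))) (≢⇒≡ᵇ≡false differ) ⟩
      suc (2 * τ ⌊ p /2⌋)           ≡⟨ sym (merge-even σ τ even) ⟩
      lab p                         ≡⟨ sym (cong (if_then lab u else lab p) (≢⇒≡ᵇ≡false p≁v)) ⟩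
      joined p                      ∎
      where
      open ≡-Reasoning
      p≁v : lab p ≢ lab v
      p≁v p~v = differ (*-cancelˡ-≡ _ _ 2 (suc-injective (trans (sym (merge-even σ τ even)) (trans p~v (merge-even σ τ even-v)))))
    merge≗joined : ∀ p → merge σ τ' p ≡ joined p
    merge≗joined p = byParity (isEven p) refl
      where
      byParity : ∀ b → isEven p ≡ b → merge σ τ' p ≡ joined p
      byParity true = joinedEven
      byParity false = joinedOdd
    τ'u≡τ'v : τ' hu ≡ τ' hv
    τ'u≡τ'v rewrite ≡⇒≡ᵇ≡true {τ hv} refl with τ hu ≡ᵇ τ hv
    ... | true = refl
    ... | false = refl
    τu≡τv : τ hu ≡ τ hv
    τu≡τv = proj₂ dual τ' (nonCrossing-≗ merge≗joined joined-nonCrossing) hu hv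
              (⌊n/2⌋-inRange n u even-u 1≤u (≤-trans (<⇒≤ u<v) v≤N))
              (⌊n/2⌋-inRange n v even-v (≤-trans 1≤u (<⇒≤ u<v)) v≤N) τ'u≡τ'v

  nc : NonCrossing N lab
  nc = proj₁ dual

  blockSpan-closed : ∀ {g h} → 1 ≤ g → g ≤ h → h ≤ N → lab g ≡ lab h → hasPrev g ≡ false → hasNext h ≡ false →
    ∀ y z → g ≤ y → y ≤ h → 1 ≤ z → z ≤ N → lab y ≡ lab z → g ≤ z × z ≤ h
  blockSpan-closed {g} {h} 1≤g g≤h h≤N g~h noPrev noNext y z g≤y y≤h 1≤z z≤N y~z with lab y ≟ lab g
  ... | yes y~g = g≤z , z≤h
    where
    g≤z : g ≤ z
    g≤z with <-cmp z g
    ... | tri< z<g _ _ = ⊥-elim (hasPrev≡false⇒ noPrev z 1≤z z<g (trans (sym y~g) y~z))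
    ... | tri≈ _ z≡g _ = ≤-reflexive (sym z≡g)
    ... | tri> _ _ g<z = <⇒≤ g<z
    z≤h : z ≤ h
    z≤h with <-cmp z h
    ... | tri< z<h _ _ = <⇒≤ z<h
    ... | tri≈ _ z≡h _ = ≤-reflexive z≡h
    ... | tri> _ _ h<z = ⊥-elim (hasNext≡false⇒ noNext z h<z z≤N (trans (sym g~h) (trans (sym y~g) y~z)))
  ... | no y≁g = g≤z , z≤h
    where
    g<y : g < y
    g<y with m≤n⇒m<n∨m≡n g≤y
    ... | inj₁ g<y = g<y
    ... | inj₂ g≡y = ⊥-elim (y≁g (cong lab (sym g≡y)))
    y<h : y < h
    y<h with m≤n⇒m<n∨m≡n y≤h
    ... | inj₁ y<h = y<h
    ... | inj₂ y≡h = ⊥-elim (y≁g (trans (cong lab y≡h) (sym g~h)))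
    g≤z : g ≤ z
    g≤z with <-cmp z g
    ... | tri< z<g _ _ = ⊥-elim (y≁g (trans y~z (nc z g y h 1≤z z<g g<y y<h h≤N (sym y~z) g~h)))
    ... | tri≈ _ z≡g _ = ≤-reflexive (sym z≡g)
    ... | tri> _ _ g<z = <⇒≤ g<z
    z≤h : z ≤ h
    z≤h with <-cmp z h
    ... | tri< z<h _ _ = <⇒≤ z<h
    ... | tri≈ _ z≡h _ = ⊥-elim (y≁g (trans y~z (trans (cong lab z≡h) (sym g~h))))
    ... | tri> _ _ h<z = ⊥-elim (y≁g (sym (nc g y h z 1≤g g<y y<h h<z z≤N g~h y~z)))

  -- A gap x (no successor of x, no predecessor of x + 1) outside the block of 1 would sit
  -- at the end of a block span enclosed by two tilde points of one τ-block.
  gapInFirstBlock : ∀ x → 1 ≤ x → suc x ≤ N → isGap x ≡ true → lab x ≡ lab 1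
  gapInFirstBlock x 1≤x x<N gap = byParity (isEven x) refl
    where
    noNext : hasNext x ≡ false
    noNext = proj₁ (isGap≡true⇒ x gap)
    noPrev : hasPrev (suc x) ≡ false
    noPrev = proj₂ (isGap≡true⇒ x gap)
    odd⇒even : ∀ p → isEven p ≡ false → isEven (suc p) ≡ true
    odd⇒even _ = cong not
    oddCase : isEven x ≡ false → lab x ≡ lab 1
    oddCase odd-x with firstOfBlock x 1≤x
    ... | g , 1≤g , g≤x , x~g , noPrev-g with m≤n⇒m<n∨m≡n 1≤g
    ...   | inj₂ refl = x~g
    ...   | inj₁ (s≤s {n = u} 1≤u) = ⊥-elim (not-¬ refl (trans (sym (hasPrev≡true 1≤u u<1+x (sym u~1+x))) noPrev))
      where
      u<1+x : u < suc x
      u<1+x = s≤s (<⇒≤ g≤x)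
      even-u : isEven u ≡ true
      even-u = not-injective (trans (sym (merge-sameParity σ τ x~g)) odd-x)
      u~1+x : lab u ≡ lab (suc x)
      u~1+x = evenEnds-sameBlock 1≤u u<1+x x<N even-u (odd⇒even x odd-x) inside
        where
        inside : ∀ y z → u < y → y < suc x → 1 ≤ z → z ≤ N → lab y ≡ lab z → u < z × z < suc x
        inside y z u<y y<1+x 1≤z z≤N y~z
          with blockSpan-closed 1≤g g≤x (≤-trans (n≤1+n x) x<N) (sym x~g) noPrev-g noNext y z u<y (≤-pred y<1+x) 1≤z z≤N y~z
        ... | g≤z , z≤x = g≤z , s≤s z≤x
    evenCase : isEven x ≡ true → ⊥
    evenCase even-x with lastOfBlock (suc x) x<N
    ... | l , x<l , l≤N , 1+x~l , noNext-l = not-¬ refl (trans (sym (hasNext≡true x<1+l 1+l≤N x~1+l)) noNext)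
      where
      odd-l : isEven l ≡ false
      odd-l = trans (sym (merge-sameParity σ τ 1+x~l)) (cong not even-x)
      x<1+l : x < suc l
      x<1+l = s≤s (<⇒≤ x<l)
      1+l≤N : suc l ≤ N
      1+l≤N with m≤n⇒m<n∨m≡n l≤N
      ... | inj₁ l<N = l<N
      ... | inj₂ refl = ⊥-elim (not-¬ refl (trans (sym (isEven-2* n)) odd-l))
      x~1+l : lab x ≡ lab (suc l)
      x~1+l = evenEnds-sameBlock 1≤x x<1+l 1+l≤N even-x (odd⇒even l odd-l) inside
        where
        inside : ∀ y z → x < y → y < suc l → 1 ≤ z → z ≤ N → lab y ≡ lab z → x < z × z < suc l
        inside y z x<y y<1+l 1≤z z≤N y~z
          with blockSpan-closed (s≤s z≤n) x<l l≤N 1+x~l noPrev noNext-l y z x<y (≤-pred y<1+l) 1≤z z≤N y~z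
        ... | x<z , z≤l = x<z , s≤s z≤l
    byParity : ∀ b → isEven x ≡ b → lab x ≡ lab 1
    byParity true even-x = ⊥-elim (evenCase even-x)
    byParity false odd-x = oddCase odd-x

-- Concordance in terms of σ and τ

sumFrom-oddEven : ∀ f k → sumFrom f 1 (2 * k) ≡ sumFrom (λ j → f (2 * j ∸ 1)) 1 k + sumFrom (λ j → f (2 * j)) 1 k
sumFrom-oddEven f zero = refl
sumFrom-oddEven f (suc k) = begin
  sumFrom f 1 (2 * suc k)                                           ≡⟨ cong (sumFrom f 1) (twice-suc k) ⟩
  sumFrom f 1 (2 * k + 2)                                           ≡⟨ sumFrom-+ f 1 (2 * k) 2 ⟩
  sumFrom f 1 (2 * k) + (f (suc (2 * k)) + (f (2 + 2 * k) + 0))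
    ≡⟨ cong₂ (λ s t → s + (f (suc (2 * k)) + t)) (sumFrom-oddEven f k) (+-identityʳ _) ⟩
  (O + E) + (f (suc (2 * k)) + f (2 + 2 * k))                        ≡⟨ interchange O E _ _ ⟩
  (O + f (suc (2 * k))) + (E + f (2 + 2 * k))
    ≡⟨ cong₂ _+_ (sym (trans (sumFrom-last _ 1 k) (cong (λ m → O + f (m ∸ 1)) (*-suc 2 k))))
                 (sym (trans (sumFrom-last _ 1 k) (cong (λ m → E + f m) (*-suc 2 k)))) ⟩
  sumFrom (λ j → f (2 * j ∸ 1)) 1 (suc k) + sumFrom (λ j → f (2 * j)) 1 (suc k) ∎
  where
  open ≡-Reasoning
  O = sumFrom (λ j → f (2 * j ∸ 1)) 1 k
  E = sumFrom (λ j → f (2 * j)) 1 k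
  twice-suc : ∀ k → 2 * suc k ≡ 2 * k + 2
  twice-suc = solve-∀

⌊2n/2⌋≡n : ∀ j → ⌊ 2 * j /2⌋ ≡ j
⌊2n/2⌋≡n j = trans (cong (λ m → ⌊ j + m /2⌋) (+-identityʳ j)) (sym (n≡⌊n+n/2⌋ j))

1+[2n∸1]≡2n : ∀ {j} → 1 ≤ j → suc (2 * j ∸ 1) ≡ 2 * j
1+[2n∸1]≡2n {j} 1≤j = m+[n∸m]≡n (≤-trans 1≤j (m≤m+n j (j + 0)))

merge-oddPoint : ∀ σ τ {j} → 1 ≤ j → merge σ τ (2 * j ∸ 1) ≡ 2 * σ j
merge-oddPoint σ τ {j} 1≤j =
  trans (merge-odd σ τ odd) (cong (λ m → 2 * σ m) (trans (cong ⌊_/2⌋ (1+[2n∸1]≡2n 1≤j)) (⌊2n/2⌋≡n j)))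
  where
  odd : isEven (2 * j ∸ 1) ≡ false
  odd = not-injective (trans (cong isEven (1+[2n∸1]≡2n 1≤j)) (isEven-2* j))

merge-evenPoint : ∀ σ τ j → merge σ τ (2 * j) ≡ suc (2 * τ j)
merge-evenPoint σ τ j = trans (merge-even σ τ (isEven-2* j)) (cong (λ m → suc (2 * τ m)) (⌊2n/2⌋≡n j))

2*-≡ᵇ : ∀ a b → (2 * a ≡ᵇ 2 * b) ≡ (a ≡ᵇ b)
2*-≡ᵇ a b with a ≟ b
... | yes refl = trans (≡⇒≡ᵇ≡true {2 * a} refl) (sym (≡⇒≡ᵇ≡true {a} refl))
... | no a≢b = trans (≢⇒≡ᵇ≡false (a≢b ∘ *-cancelˡ-≡ a b 2)) (sym (≢⇒≡ᵇ≡false a≢b))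

2*≢1+2* : ∀ a b → 2 * a ≢ suc (2 * b)
2*≢1+2* a b eq = not-¬ refl (trans (sym (isEven-2* a)) (trans (cong isEven eq) (cong not (isEven-2* b))))

∧-not-∈ᵇ⇔ : ∀ {a b x I} → ((a ≡ᵇ b) ∧ not (x ∈ᵇ I)) ≡ true ⇔ (b ≡ a × ¬ x ∈ I)
∧-not-∈ᵇ⇔ {a} {b} {x} {I} = mk⇔ to from
  where
  to : ((a ≡ᵇ b) ∧ not (x ∈ᵇ I)) ≡ true → b ≡ a × ¬ x ∈ I
  to h with a ≡ᵇ b in a≡b | x ∈ᵇ I in x∈
  ... | true | false = sym (≡ᵇ≡true⇒≡ a≡b) , λ x∈I → not-¬ refl (trans (sym (∈⇒∈ᵇ x∈I)) x∈)
  from : b ≡ a × ¬ x ∈ I → ((a ≡ᵇ b) ∧ not (x ∈ᵇ I)) ≡ true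
  from (b≡a , x∉I) with x ∈ᵇ I in x∈
  ... | true = ⊥-elim (x∉I (∈ᵇ⇒∈ I x∈))
  ... | false = trans (∧-identityʳ (a ≡ᵇ b)) (≡⇒≡ᵇ≡true (sym b≡a))

exactlyOne⇔count : ∀ n {P : ℕ → Set} (p : ℕ → Bool) → (∀ j → p j ≡ true ⇔ P j) → ExactlyOne n P ⇔ (countFrom p 1 n ≡ 1)
exactlyOne⇔count n {P} p p⇔P = mk⇔ to from
  where
  toWithin : ∀ {j} → InRange n j → Within 1 n j
  toWithin (1≤j , j≤n) = 1≤j , s≤s j≤n
  fromWithin : ∀ {j} → Within 1 n j → InRange n j
  fromWithin (1≤j , j<) = 1≤j , ≤-pred j<
  to : ExactlyOne n P → countFrom p 1 n ≡ 1
  to (w , rw , Pw , unique) = countFrom-unique p 1 n w (toWithin rw) (Equivalence.from (p⇔P w) Pw)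
    (λ x rx px → unique x (fromWithin rx) (Equivalence.to (p⇔P x) px))
  from : countFrom p 1 n ≡ 1 → ExactlyOne n P
  from count with countFrom≡1⇒unique p 1 n count
  ... | w , rw , pw , unique = w , fromWithin rw , Equivalence.to (p⇔P w) pw ,
    (λ j rj Pj → unique j (toWithin rj) (Equivalence.from (p⇔P j) Pj))

module MainProof (n : ℕ) (σ τ : Labelling) (1≤n : 1 ≤ n) (dual : IsDual n σ τ) where

  open MergedDual n σ τ dual
  open Blocks N lab
  open Alternating nc (merge-alternates σ τ)
  open GapsInFirstBlock gapInFirstBlock
  open Expansion N lab nc (merge-alternates σ τ) gapInFirstBlock

  1≤N : 1 ≤ N
  1≤N = ≤-trans 1≤n (m≤m+n n (n + 0))

  brackets≡ : bracketsOf n σ τ ≡ bracketsFrom 1 N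
  brackets≡ = cong (concatMap (λ a → firstOf a (successors N lab a))) (range-interval N)

  endsDiffer : lab N ≢ lab 1
  endsDiffer same = not-¬ {true} refl (trans (sym (isEven-2* n)) (merge-sameParity σ τ {N} {1} same))

  bracketCount : length (bracketsFrom 1 N) ≡ n ∸ 1
  bracketCount = trans (length-bracketsFrom 1 N) (cong pred (*-cancelˡ-≡ (suc (countFrom hasNext 1 N)) n 2 (countNext-total 1≤N endsDiffer)))

  bracketFactors : All (λ ab → (proj₁ ab % 2 ≡ proj₂ ab % 2) × (∀ p → factor ab p ≡ altsum ab p)) (bracketsFrom 1 N)
  bracketFactors = All-bracketsFrom bracketFactor 1 N ≤-refl
    where
    bracketFactor : ∀ {a b} → 1 ≤ a → IsNext a b → (a % 2 ≡ b % 2) × (∀ p → factor (a , b) p ≡ altsum (a , b) p)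
    bracketFactor {a} {b} 1≤a b-next =
      sym (trans (cong (_% 2) (sym gap)) ([m+2k]%2≡m%2 a (suc X))) , factor≡altsum X gap
      where
      X = countFrom hasNext (suc a) (b ∸ suc a)
      gap : a + 2 * suc X ≡ b
      gap = nextInterval-count 1≤a b-next

  oddWithin : ∀ {i} → InRange n i → Within 1 N (2 * i ∸ 1)
  oddWithin {i} (1≤i , i≤n) =
    ≤-pred (subst (2 ≤_) (sym (1+[2n∸1]≡2n 1≤i)) (*-monoʳ-≤ 2 1≤i)) ,
    s≤s (≤-trans (m∸n≤m (2 * i) 1) (*-monoʳ-≤ 2 i≤n))

  evenWithin : ∀ {i} → InRange n i → Within 1 N (2 * i)
  evenWithin (1≤i , i≤n) = ≤-trans 1≤i (m≤m+n _ _) , s≤s (*-monoʳ-≤ 2 i≤n)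

  oddOrEven : ∀ y → Within 1 N y → Σ ℕ λ i → InRange n i × (y ≡ 2 * i ∸ 1 ⊎ y ≡ 2 * i)
  oddOrEven y (1≤y , y<) = byParity (isEven y) refl
    where
    byParity : ∀ b → isEven y ≡ b → Σ ℕ λ i → InRange n i × (y ≡ 2 * i ∸ 1 ⊎ y ≡ 2 * i)
    byParity true even = ⌊ y /2⌋ , ⌊n/2⌋-inRange n y even 1≤y (≤-pred y<) , inj₂ (sym (2*⌊n/2⌋≡n y even))
    byParity false odd = ⌊ suc y /2⌋ , ⌊n/2⌋-inRange n (suc y) (cong not odd) (s≤s z≤n) y<N ,
                         inj₁ (cong pred (sym (2*⌊n/2⌋≡n (suc y) (cong not odd))))
      where
      y<N : suc y ≤ N
      y<N with m≤n⇒m<n∨m≡n (≤-pred y<)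
      ... | inj₁ y<N = y<N
      ... | inj₂ refl = ⊥-elim (not-¬ {true} refl (trans (sym (isEven-2* n)) odd))

  module _ (I : List ℕ) where

    oddCount : ∀ i → 1 ≤ i → countFrom (free (2 * i ∸ 1) I) 1 N ≡ countFrom (λ j → (σ i ≡ᵇ σ j) ∧ not (2 * j ∸ 1 ∈ᵇ I)) 1 n
    oddCount i 1≤i = begin
      countFrom (free y I) 1 N                                                          ≡⟨ sumFrom-oddEven _ n ⟩
      countFrom (λ j → free y I (2 * j ∸ 1)) 1 n + countFrom (λ j → free y I (2 * j)) 1 n
        ≡⟨ cong₂ _+_ (sumFrom-cong 1 n (λ j rj → cong boolToℕ (oddPoint j (proj₁ rj)))) (countFrom-none _ 1 n (λ j _ → evenPoint j)) ⟩
      countFrom (λ j → (σ i ≡ᵇ σ j) ∧ not (2 * j ∸ 1 ∈ᵇ I)) 1 n + 0                   ≡⟨ +-identityʳ _ ⟩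
      countFrom (λ j → (σ i ≡ᵇ σ j) ∧ not (2 * j ∸ 1 ∈ᵇ I)) 1 n                       ∎
      where
      open ≡-Reasoning
      y = 2 * i ∸ 1
      oddPoint : ∀ j → 1 ≤ j → free y I (2 * j ∸ 1) ≡ (σ i ≡ᵇ σ j) ∧ not (2 * j ∸ 1 ∈ᵇ I)
      oddPoint j 1≤j = cong (_∧ not (2 * j ∸ 1 ∈ᵇ I))
        (trans (cong₂ _≡ᵇ_ (merge-oddPoint σ τ 1≤i) (merge-oddPoint σ τ 1≤j)) (2*-≡ᵇ (σ i) (σ j)))
      evenPoint : ∀ j → free y I (2 * j) ≡ false
      evenPoint j = cong (_∧ not (2 * j ∈ᵇ I))
        (trans (cong₂ _≡ᵇ_ (merge-oddPoint σ τ 1≤i) (merge-evenPoint σ τ j)) (≢⇒≡ᵇ≡false (2*≢1+2* (σ i) (τ j))))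

    evenCount : ∀ i → countFrom (free (2 * i) I) 1 N ≡ countFrom (λ j → (τ i ≡ᵇ τ j) ∧ not (2 * j ∈ᵇ I)) 1 n
    evenCount i = begin
      countFrom (free y I) 1 N                                                          ≡⟨ sumFrom-oddEven _ n ⟩
      countFrom (λ j → free y I (2 * j ∸ 1)) 1 n + countFrom (λ j → free y I (2 * j)) 1 n
        ≡⟨ cong₂ _+_ (countFrom-none _ 1 n (λ j rj → oddPoint j (proj₁ rj))) (sumFrom-cong 1 n (λ j _ → cong boolToℕ (evenPoint j))) ⟩
      countFrom (λ j → (τ i ≡ᵇ τ j) ∧ not (2 * j ∈ᵇ I)) 1 n                           ∎
      where
      open ≡-Reasoning
      y = 2 * i
      oddPoint : ∀ j → 1 ≤ j → free y I (2 * j ∸ 1) ≡ false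
      oddPoint j 1≤j = cong (_∧ not (2 * j ∸ 1 ∈ᵇ I))
        (trans (cong₂ _≡ᵇ_ (merge-evenPoint σ τ i) (merge-oddPoint σ τ 1≤j)) (≢⇒≡ᵇ≡false (2*≢1+2* (σ j) (τ i) ∘ sym)))
      evenPoint : ∀ j → free y I (2 * j) ≡ (τ i ≡ᵇ τ j) ∧ not (2 * j ∈ᵇ I)
      evenPoint j = cong (_∧ not (2 * j ∈ᵇ I))
        (trans (cong₂ _≡ᵇ_ (merge-evenPoint σ τ i) (merge-evenPoint σ τ j)) (2*-≡ᵇ (τ i) (τ j)))

    concordant⇔ : All (InRange N) I → Concordant n σ τ I ⇔ ConcordantFrom 1 N I
    concordant⇔ bounds = mk⇔ to from
      where
      oneσ : ∀ i → ExactlyOne n (λ j → σ j ≡ σ i × ¬ (2 * j ∸ 1) ∈ I) ⇔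
                   (countFrom (λ j → (σ i ≡ᵇ σ j) ∧ not (2 * j ∸ 1 ∈ᵇ I)) 1 n ≡ 1)
      oneσ i = exactlyOne⇔count n _ (λ j → ∧-not-∈ᵇ⇔)
      oneτ : ∀ i → ExactlyOne n (λ j → τ j ≡ τ i × ¬ (2 * j) ∈ I) ⇔
                   (countFrom (λ j → (τ i ≡ᵇ τ j) ∧ not (2 * j ∈ᵇ I)) 1 n ≡ 1)
      oneτ i = exactlyOne⇔count n _ (λ j → ∧-not-∈ᵇ⇔)
      to : Concordant n σ τ I → ConcordantFrom 1 N I
      to (concσ , concτ) = All-map proj₁ bounds , counted
        where
        counted : ∀ y → Within 1 N y → countFrom (free y I) 1 N ≡ 1
        counted y ry with oddOrEven y ry
        ... | i , ri , inj₁ refl = trans (oddCount i (proj₁ ri)) (Equivalence.to (oneσ i) (concσ i ri))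
        ... | i , ri , inj₂ refl = trans (evenCount i) (Equivalence.to (oneτ i) (concτ i ri))
      from : ConcordantFrom 1 N I → Concordant n σ τ I
      from (_ , count) =
        (λ i ri → Equivalence.from (oneσ i) (trans (sym (oddCount i (proj₁ ri))) (count _ (oddWithin ri)))) ,
        (λ i ri → Equivalence.from (oneτ i) (trans (sym (evenCount i)) (count _ (evenWithin ri))))

  coefficients : ∀ I → Linked _<_ I → All (InRange (2 * n)) I → length I ≡ n ∸ 1 →
    wedgeCoeff (map factor (bracketsFrom 1 N)) I IsIndicatorOf Concordant n σ τ I
  coefficients I linked bounds len =
    indicator-resp refl (concordant⇔ I bounds)
      (expansion N 1 ≤-refl refl I (Linked⇒AllPairs <-trans linked) (All-map proj₂ bounds) (trans len (sym bracketCount)))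

mainTheorem2 : (n : ℕ) (σ τ : Labelling) → 1 ≤ n → NonCrossing n σ → IsDual n σ τ →
    length (bracketsOf n σ τ) ≡ n ∸ 1
    × (∀ (I : List ℕ) → Linked _<_ I → All (InRange (2 * n)) I → length I ≡ n ∸ 1 →
        (Concordant n σ τ I → wedgeCoeff (map factor (bracketsOf n σ τ)) I ≡ + 1)
        × (¬ Concordant n σ τ I → wedgeCoeff (map factor (bracketsOf n σ τ)) I ≡ + 0))
    × All (λ ab → (proj₁ ab % 2 ≡ proj₂ ab % 2) × (∀ p → factor ab p ≡ altsum ab p))
          (bracketsOf n σ τ)
mainTheorem2 n σ τ 1≤n _ dual rewrite MainProof.brackets≡ n σ τ 1≤n dual = bracketCount , coefficients , bracketFactors
  where open MainProof n σ τ 1≤n dual
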